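{- Let $p$ be an odd prime, $a$ an integer with $p\nmid a$, $b=b_0p^{b_1}$, $c=c_0p^{c_1}$ with $0\le b_1\le c_1$, $\gcd(b_0,p)=\gcd(c_0,p)=1$, and let $m=m_0p^{m_1}$ be a nonzero integer with $\gcd(m_0,p)=1$. Let $k>m_1$ be an integer and for $0\le\tau\le k-1$ set $$s_{k,\tau}=\sum_{t_0\in(\mathbb Z/p^{k-\tau}\mathbb Z)^*}e\!\left(\frac{ -m_0t_0p^{m_1+\tau}}{p^k}\right)G(at_0p^\tau;p^k)\,G(b_0t_0p^{b_1+\tau};p^k)\,G(c_0t_0p^{c_1+\tau};p^k).$$ If $m_1<b_1$, then $$s_{k,k-m_1-1}=\begin{cases}p^{3k+m_1/2}\left(\frac{am_0}{p}\right), & m_1\text{ even},\\ -p^{3k+m_1/2-1/2}, & m_1\text{ odd}.\end{cases}$$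
   Context: $e(w)=e^{2\pi i w}$; $G(a;q)=\sum_{j=0}^{q-1}e\!\left(\frac{aj^2}{q}\right)$; $\left(\frac{\cdot}{p}\right)$ is the Legendre symbol. -}

module Defs where

open import Data.Bool using (Bool; if_then_else_)
open import Data.Nat as ℕ using (ℕ; zero; suc; _∸_; _<_; _≡ᵇ_)
open import Data.Integer as ℤ using (ℤ; +_; _+_; _-_; _*_; -_; _%ℕ_; ∣_∣)
open import Data.List using (List; []; _∷_; map; foldr; upTo; filter; concatMap; concat)
open import Data.Product using (_×_; _,_; ∃)
open import Relation.Binary.PropositionalEquality using (_≡_)
open import Relation.Nullary using (does)
open import Data.Nat.Divisibility using (_∣?_)
open import Data.Nat.Coprimality using (coprime?)
open import Data.List.Relation.Unary.Any using (any?)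

sumℤ : List ℤ → ℤ
sumℤ = foldr _+_ (+ 0)

-- residue of an integer exponent modulo n (n ≥ 1 in all uses)
modN : ℤ → ℕ → ℕ
modN e zero = 0
modN e (suc q) = e %ℕ suc q

-- A formal exponential sum relative to a modulus n:
-- the list [(c₁,e₁),…] denotes Σ cᵢ · e(eᵢ / n) = Σ cᵢ ζₙ^{eᵢ}, ζₙ = e(1/n).
ExpSum : Set
ExpSum = List (ℤ × ℤ)

_⊗_ : ExpSum → ExpSum → ExpSum
S ⊗ T = concatMap (λ { (c , e) → map (λ { (d , f) → (c * d , e + f) }) T }) S

infixl 7 _⊗_

-- coefficient of ζₙ^r (0 ≤ r < n) after reducing exponents mod n,
-- i.e. the image of S in ℤ[x]/(xⁿ - 1)
coeff : ℕ → ExpSum → ℕ → ℤ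
coeff n S r = sumℤ (map (λ { (c , e) → if modN e n ≡ᵇ r then c else + 0 }) S)

-- Equality of the complex numbers denoted by S and T, with n = p^k, k ≥ 1:
-- equality in ℤ[ζ_{p^k}] ≅ ℤ[x]/(Φ_{p^k}), where
-- Φ_{p^k}(x) = Σ_{j<p} x^{j p^{k-1}} is the p^k-th cyclotomic polynomial.
-- Concretely: image(S) - image(T) ∈ ℤ[x]/(xⁿ-1) is a multiple h · Φ_{p^k}.
CycEq : ℕ → ℕ → ExpSum → ExpSum → Set
CycEq p k S T =
  let n = p ℕ.^ k in
  ∃ λ (h : ℕ → ℤ) → ∀ r → r < n →
    coeff n S r - coeff n T r
      ≡ sumℤ (map (λ j → h (modN (+ r - + (j ℕ.* p ℕ.^ (k ∸ 1))) n)) (upTo p))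

const : ℤ → ExpSum
const N = (N , + 0) ∷ []

gauss : ℤ → ℕ → ExpSum
gauss A q = map (λ j → (+ 1 , A * (+ j * + j))) (upTo q)

sₖτ : (p : ℕ) (a b₀ : ℤ) (b₁ : ℕ) (c₀ : ℤ) (c₁ : ℕ) (m₀ : ℤ) (m₁ k τ : ℕ) → ExpSum
sₖτ p a b₀ b₁ c₀ c₁ m₀ m₁ k τ =
  concatMap term (filter (λ t → coprime? t (p ℕ.^ (k ∸ τ))) (upTo (p ℕ.^ (k ∸ τ))))
  where
  q = p ℕ.^ k
  term : ℕ → ExpSum
  term t₀ =
    ((+ 1 , - (m₀ * + t₀ * + (p ℕ.^ (m₁ ℕ.+ τ)))) ∷ [])
      ⊗ gauss (a * + t₀ * + (p ℕ.^ τ)) q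
      ⊗ gauss (b₀ * + t₀ * + (p ℕ.^ (b₁ ℕ.+ τ))) q
      ⊗ gauss (c₀ * + t₀ * + (p ℕ.^ (c₁ ℕ.+ τ))) q

legendre : ℤ → ℕ → ℤ
legendre A p =
  if does (p ∣? ∣ A ∣) then + 0
  else if does (any? (λ x → modN (+ x * + x - A) p ℕ.≟ 0) (upTo p)) then + 1
  else - (+ 1)

-- Since b₁ + τ and c₁ + τ are at least k, the b- and c-Gauss sums in every term of s_{k,τ}
-- are trivial and equal p^k. Hence the coefficient of ζ^r in s_{k,τ} is p^{2k} times the
-- number C(r) = multiplicity r of pairs (t, j), t a unit modulo p^{m₁+1} and j < p^k, with
-- t p^τ (a j² - m₀ p^{m₁}) ≡ r (mod p^k). Replacing t by t w for a unit w shows C(r) = C(w r);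
-- so C(r) only depends on r mod N = p^{k-1} unless N ∣ r, and C(i N) = C(N) for 0 < i < p.
-- Therefore s_{k,τ} - T is a multiple of the cyclotomic polynomial Φ_{p^k} = Σ_{j<p} x^{j N}
-- as soon as T = p^{2k} (C(0) - C(N)). Counting Σ_{i<p} C(i N) directly gives
-- C(0) - C(N) = p^{m₁} (p A - B), where A = count-Q∣Z and B = count-p^m₁∣Z count the j < p^k
-- with p^{m₁+1}, respectively p^{m₁}, dividing a j² - m₀ p^{m₁}. Both follow from the p-adic
-- valuation of j²: B = p^{k-⌈m₁/2⌉}, A = 0 for odd m₁, and for even m₁ = 2l,
-- A = p^{l+τ} · #{x < p : a x² ≡ m₀} = p^{l+τ} (1 + (a m₀ / p)).

module Submission where

open import Defs

module FiniteSums where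

  open import Data.Bool using (if_then_else_)
  open import Data.Nat as ℕ using (ℕ; zero; suc)
  import Data.Nat.Properties as ℕP
  import Data.Nat.Divisibility as ℕD
  open import Data.Integer using (ℤ; +_; _+_; _*_; 0ℤ; 1ℤ)
  open import Data.Integer.Properties
  open import Algebra.Properties.CommutativeSemigroup +-commutativeSemigroup using (interchange)
  open import Data.List using (List; []; _∷_; _++_; map; upTo; filter)
  import Data.List.Properties as ℓP
  open import Data.Empty using (⊥-elim)
  open import Relation.Nullary using (¬_; Dec; yes; no; does)
  open import Relation.Binary.PropositionalEquality hiding ([_])
  open ≡-Reasoning
  open import Function using (_∘_)
  open import Data.Product using (_×_; _,_)
  open import Data.Sum using (_⊎_; [_,_])

  ∑< : ℕ → (ℕ → ℤ) → ℤ
  ∑< zero f = 0ℤ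
  ∑< (suc n) f = ∑< n f + f n

  sumℤ-++ : ∀ xs ys → sumℤ (xs ++ ys) ≡ sumℤ xs + sumℤ ys
  sumℤ-++ [] ys = sym (+-identityˡ _)
  sumℤ-++ (x ∷ xs) ys = trans (cong (_+_ x) (sumℤ-++ xs ys)) (sym (+-assoc x _ _))

  sumℤ-map-upTo : ∀ n f → sumℤ (map f (upTo n)) ≡ ∑< n f
  sumℤ-map-upTo zero f = refl
  sumℤ-map-upTo (suc n) f = begin
    sumℤ (map f (upTo (suc n)))          ≡⟨ cong sumℤ∘map (sym (ℓP.upTo-∷ʳ n)) ⟩
    sumℤ (map f (upTo n ++ (n ∷ [])))    ≡⟨ cong sumℤ (ℓP.map-++ f (upTo n) (n ∷ [])) ⟩
    sumℤ (map f (upTo n) ++ (f n ∷ []))  ≡⟨ sumℤ-++ (map f (upTo n)) (f n ∷ []) ⟩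
    sumℤ (map f (upTo n)) + (f n + 0ℤ)   ≡⟨ cong₂ _+_ (sumℤ-map-upTo n f) (+-identityʳ (f n)) ⟩
    ∑< n f + f n                         ∎
    where
    sumℤ∘map : List ℕ → ℤ
    sumℤ∘map xs = sumℤ (map f xs)

  ∑<-cong : ∀ n {f g} → (∀ i → i ℕ.< n → f i ≡ g i) → ∑< n f ≡ ∑< n g
  ∑<-cong zero eq = refl
  ∑<-cong (suc n) eq =
    cong₂ _+_ (∑<-cong n (λ i i<n → eq i (ℕP.m<n⇒m<1+n i<n))) (eq n ℕP.≤-refl)

  ∑<-+ : ∀ n f g → ∑< n (λ i → f i + g i) ≡ ∑< n f + ∑< n g
  ∑<-+ zero f g = refl
  ∑<-+ (suc n) f g = trans (cong (_+ (f n + g n)) (∑<-+ n f g)) (interchange (∑< n f) (∑< n g) (f n) (g n))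

  ∑<-*ˡ : ∀ n c f → ∑< n (λ i → c * f i) ≡ c * ∑< n f
  ∑<-*ˡ zero c f = sym (*-zeroʳ c)
  ∑<-*ˡ (suc n) c f = trans (cong (_+ c * f n) (∑<-*ˡ n c f)) (sym (*-distribˡ-+ c _ _))

  ∑<-const : ∀ n c → ∑< n (λ _ → c) ≡ + n * c
  ∑<-const zero c = sym (*-zeroˡ c)
  ∑<-const (suc n) c = begin
    ∑< n (λ _ → c) + c    ≡⟨ cong₂ _+_ (∑<-const n c) (sym (*-identityˡ c)) ⟩
    + n * c + 1ℤ * c      ≡⟨ sym (*-distribʳ-+ c (+ n) 1ℤ) ⟩
    (+ n + 1ℤ) * c        ≡⟨ cong (λ m → + m * c) (ℕP.+-comm n 1) ⟩
    + suc n * c           ∎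

  ∑<-≡0 : ∀ n f → (∀ i → i ℕ.< n → f i ≡ 0ℤ) → ∑< n f ≡ 0ℤ
  ∑<-≡0 n f eq = trans (∑<-cong n eq) (trans (∑<-const n 0ℤ) (*-zeroʳ (+ n)))

  ∑<-comm : ∀ m n (f : ℕ → ℕ → ℤ) →
    ∑< m (λ i → ∑< n (λ j → f i j)) ≡ ∑< n (λ j → ∑< m (λ i → f i j))
  ∑<-comm zero n f = sym (∑<-≡0 n _ (λ _ _ → refl))
  ∑<-comm (suc m) n f = begin
    ∑< m (λ i → ∑< n (f i)) + ∑< n (f m)        ≡⟨ cong (_+ ∑< n (f m)) (∑<-comm m n f) ⟩
    ∑< n (λ j → ∑< m (λ i → f i j)) + ∑< n (f m) ≡⟨ sym (∑<-+ n _ (f m)) ⟩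
    ∑< n (λ j → ∑< (suc m) (λ i → f i j))        ∎

  ∑<-split : ∀ a b f → ∑< (a ℕ.+ b) f ≡ ∑< a f + ∑< b (λ i → f (a ℕ.+ i))
  ∑<-split a zero f = trans (cong (λ n → ∑< n f) (ℕP.+-identityʳ a)) (sym (+-identityʳ _))
  ∑<-split a (suc b) f = begin
    ∑< (a ℕ.+ suc b) f                                 ≡⟨ cong (λ n → ∑< n f) (ℕP.+-suc a b) ⟩
    ∑< (a ℕ.+ b) f + f (a ℕ.+ b)                       ≡⟨ cong (_+ f (a ℕ.+ b)) (∑<-split a b f) ⟩
    ∑< a f + ∑< b (λ i → f (a ℕ.+ i)) + f (a ℕ.+ b)    ≡⟨ +-assoc (∑< a f) _ _ ⟩
    ∑< a f + ∑< (suc b) (λ i → f (a ℕ.+ i))            ∎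

  ∑<-sucˡ : ∀ n f → ∑< (suc n) f ≡ f 0 + ∑< n (λ i → f (suc i))
  ∑<-sucˡ n f = trans (∑<-split 1 n f) (cong (_+ ∑< n (λ i → f (suc i))) (+-identityˡ (f 0)))

  ∑<-periodic : ∀ m d f → (∀ i → f (d ℕ.+ i) ≡ f i) → ∑< (m ℕ.* d) f ≡ + m * ∑< d f
  ∑<-periodic zero d f per = sym (*-zeroˡ (∑< d f))
  ∑<-periodic (suc m) d f per = begin
    ∑< (d ℕ.+ m ℕ.* d) f                          ≡⟨ ∑<-split d (m ℕ.* d) f ⟩
    ∑< d f + ∑< (m ℕ.* d) (λ i → f (d ℕ.+ i))     ≡⟨ cong (_+_ (∑< d f)) (∑<-cong (m ℕ.* d) (λ i _ → per i)) ⟩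
    ∑< d f + ∑< (m ℕ.* d) f                       ≡⟨ cong (_+_ (∑< d f)) (∑<-periodic m d f per) ⟩
    ∑< d f + + m * ∑< d f                         ≡⟨ cong (_+ + m * ∑< d f) (sym (*-identityˡ (∑< d f))) ⟩
    1ℤ * ∑< d f + + m * ∑< d f                    ≡⟨ sym (*-distribʳ-+ (∑< d f) 1ℤ (+ m)) ⟩
    + suc m * ∑< d f                              ∎

  ∑<-multiples : ∀ m d f → .{{ℕ.NonZero d}} → (∀ j → ¬ (d ℕD.∣ j) → f j ≡ 0ℤ) →
    ∑< (m ℕ.* d) f ≡ ∑< m (λ i → f (i ℕ.* d))
  ∑<-multiples zero d f vanish = refl
  ∑<-multiples (suc m) d@(suc d-1) f vanish = begin
    ∑< (d ℕ.+ m ℕ.* d) f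
      ≡⟨ ∑<-split d (m ℕ.* d) f ⟩
    ∑< d f + ∑< (m ℕ.* d) (λ j → f (d ℕ.+ j))
      ≡⟨ cong₂ _+_ first-block (∑<-multiples m d (λ j → f (d ℕ.+ j)) vanish-shifted) ⟩
    f 0 + ∑< m (λ i → f (d ℕ.+ i ℕ.* d))
      ≡⟨ sym (∑<-sucˡ m (λ i → f (i ℕ.* d))) ⟩
    ∑< (suc m) (λ i → f (i ℕ.* d)) ∎
    where
    vanish-shifted : ∀ j → ¬ (d ℕD.∣ j) → f (d ℕ.+ j) ≡ 0ℤ
    vanish-shifted j d∤j = vanish (d ℕ.+ j) (λ d∣d+j → d∤j (ℕD.∣m+n∣m⇒∣n d∣d+j ℕD.∣-refl))
    first-block : ∑< d f ≡ f 0
    first-block = begin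
      ∑< d f
        ≡⟨ ∑<-sucˡ d-1 f ⟩
      f 0 + ∑< d-1 (λ i → f (suc i))
        ≡⟨ cong (_+_ (f 0)) (∑<-≡0 d-1 _
            (λ i i<d-1 → vanish (suc i) (λ d∣1+i → ℕP.<⇒≱ (ℕ.s≤s i<d-1) (ℕD.∣⇒≤ d∣1+i)))) ⟩
      f 0 + 0ℤ
        ≡⟨ +-identityʳ (f 0) ⟩
      f 0 ∎

  𝟙 : ∀ {P : Set} → Dec P → ℤ
  𝟙 d = if does d then 1ℤ else 0ℤ

  𝟙-yes : ∀ {P : Set} (d : Dec P) → P → 𝟙 d ≡ 1ℤ
  𝟙-yes (yes _) _ = refl
  𝟙-yes (no ¬p) p = ⊥-elim (¬p p)

  𝟙-no : ∀ {P : Set} (d : Dec P) → ¬ P → 𝟙 d ≡ 0ℤ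
  𝟙-no (yes p) ¬p = ⊥-elim (¬p p)
  𝟙-no (no _) _ = refl

  𝟙-⇔ : ∀ {P Q : Set} (d : Dec P) (e : Dec Q) → (P → Q) → (Q → P) → 𝟙 d ≡ 𝟙 e
  𝟙-⇔ (yes p) e to from = sym (𝟙-yes e (to p))
  𝟙-⇔ (no ¬p) e to from = sym (𝟙-no e (λ q → ¬p (from q)))

  𝟙-⊎ : ∀ {P Q R : Set} (d : Dec P) (e : Dec Q) (f : Dec R) →
    (P → Q ⊎ R) → (Q → P) → (R → P) → ¬ (Q × R) → 𝟙 d ≡ 𝟙 e + 𝟙 f
  𝟙-⊎ d (yes q) (yes r) _ _ _ ¬q×r = ⊥-elim (¬q×r (q , r))
  𝟙-⊎ d (yes q) (no _) _ from-q _ _ = 𝟙-yes d (from-q q)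
  𝟙-⊎ d (no _) (yes r) _ _ from-r _ = 𝟙-yes d (from-r r)
  𝟙-⊎ d (no ¬q) (no ¬r) to _ _ _ = 𝟙-no d ([ ¬q , ¬r ] ∘ to)

  sumℤ-filter : ∀ {P : ℕ → Set} (P? : ∀ x → Dec (P x)) (f : ℕ → ℤ) xs →
    sumℤ (map f (filter P? xs)) ≡ sumℤ (map (λ x → 𝟙 (P? x) * f x) xs)
  sumℤ-filter P? f [] = refl
  sumℤ-filter P? f (x ∷ xs) with P? x
  ... | yes _ = cong₂ _+_ (sym (*-identityˡ (f x))) (sumℤ-filter P? f xs)
  ... | no _ = trans (sumℤ-filter P? f xs) (sym (+-identityˡ _))

  ∑<-δ : ∀ n c (g : ℕ → ℤ) → c ℕ.< n → ∑< n (λ i → 𝟙 (i ℕ.≟ c) * g i) ≡ g c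
  ∑<-δ (suc n) c g c<1+n with c ℕ.≟ n
  ... | yes refl = begin
    ∑< c (λ i → 𝟙 (i ℕ.≟ c) * g i) + 𝟙 (c ℕ.≟ c) * g c
      ≡⟨ cong₂ _+_ (∑<-≡0 c _ (λ i i<c → off-diagonal i (ℕP.<⇒≢ i<c))) (cong (_* g c) (𝟙-yes (c ℕ.≟ c) refl)) ⟩
    0ℤ + 1ℤ * g c
      ≡⟨ trans (+-identityˡ _) (*-identityˡ (g c)) ⟩
    g c ∎
    where
    off-diagonal : ∀ i → i ≢ c → 𝟙 (i ℕ.≟ c) * g i ≡ 0ℤ
    off-diagonal i i≢c = trans (cong (_* g i) (𝟙-no (i ℕ.≟ c) i≢c)) (*-zeroˡ (g i))
  ... | no c≢n = begin
    ∑< n (λ i → 𝟙 (i ℕ.≟ c) * g i) + 𝟙 (n ℕ.≟ c) * g n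
      ≡⟨ cong₂ _+_ (∑<-δ n c g (ℕP.≤∧≢⇒< (ℕP.≤-pred c<1+n) c≢n)) (cong (_* g n) (𝟙-no (n ℕ.≟ c) (c≢n ∘ sym))) ⟩
    g c + 0ℤ * g n
      ≡⟨ +-identityʳ (g c) ⟩
    g c ∎

  ∑<-𝟙-≟ : ∀ n c → c ℕ.< n → ∑< n (λ i → 𝟙 (i ℕ.≟ c)) ≡ 1ℤ
  ∑<-𝟙-≟ n c c<n = trans (∑<-cong n (λ i _ → sym (*-identityʳ (𝟙 (i ℕ.≟ c))))) (∑<-δ n c (λ _ → 1ℤ) c<n)

  ∑<-reindex : ∀ n (φ ψ : ℕ → ℕ) (g : ℕ → ℤ) →
    (∀ t → t ℕ.< n → φ t ℕ.< n) → (∀ s → s ℕ.< n → ψ s ℕ.< n) →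
    (∀ s → s ℕ.< n → φ (ψ s) ≡ s) → (∀ t → t ℕ.< n → ψ (φ t) ≡ t) →
    ∑< n (λ t → g (φ t)) ≡ ∑< n g
  ∑<-reindex n φ ψ g φ< ψ< φψ ψφ = begin
    ∑< n (λ t → g (φ t))
      ≡⟨ ∑<-cong n (λ t t<n → sym (∑<-δ n (φ t) g (φ< t t<n))) ⟩
    ∑< n (λ t → ∑< n (λ s → 𝟙 (s ℕ.≟ φ t) * g s))
      ≡⟨ ∑<-comm n n (λ t s → 𝟙 (s ℕ.≟ φ t) * g s) ⟩
    ∑< n (λ s → ∑< n (λ t → 𝟙 (s ℕ.≟ φ t) * g s))
      ≡⟨ ∑<-cong n (λ s s<n → ∑<-cong n (λ t t<n → cong (_* g s) (transpose s t s<n t<n))) ⟩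
    ∑< n (λ s → ∑< n (λ t → 𝟙 (t ℕ.≟ ψ s) * g s))
      ≡⟨ ∑<-cong n (λ s s<n → ∑<-δ n (ψ s) (λ _ → g s) (ψ< s s<n)) ⟩
    ∑< n g ∎
    where
    transpose : ∀ s t → s ℕ.< n → t ℕ.< n → 𝟙 (s ℕ.≟ φ t) ≡ 𝟙 (t ℕ.≟ ψ s)
    transpose s t s<n t<n = 𝟙-⇔ (s ℕ.≟ φ t) (t ℕ.≟ ψ s)
      (λ s≡φt → trans (sym (ψφ t t<n)) (cong ψ (sym s≡φt)))
      (λ t≡ψs → trans (sym (φψ s s<n)) (cong φ (sym t≡ψs)))

  count-multiples : ∀ m d → .{{ℕ.NonZero d}} → ∑< (m ℕ.* d) (λ j → 𝟙 (d ℕD.∣? j)) ≡ + m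
  count-multiples m d = begin
    ∑< (m ℕ.* d) (λ j → 𝟙 (d ℕD.∣? j))       ≡⟨ ∑<-multiples m d _ (λ j d∤j → 𝟙-no (d ℕD.∣? j) d∤j) ⟩
    ∑< m (λ i → 𝟙 (d ℕD.∣? (i ℕ.* d)))        ≡⟨ ∑<-cong m (λ i _ → 𝟙-yes (d ℕD.∣? (i ℕ.* d)) (ℕD.n∣m*n i)) ⟩
    ∑< m (λ _ → 1ℤ)                          ≡⟨ trans (∑<-const m 1ℤ) (*-identityʳ (+ m)) ⟩
    + m                                      ∎

module IntegerDivisibility where

  open import Data.Bool using (true; false; T; if_then_else_)
  open import Data.Nat as ℕ using (ℕ; zero; suc; _≡ᵇ_)
  import Data.Nat.Properties as ℕP
  import Data.Nat.Divisibility as ℕD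
  import Data.Nat.Coprimality as ℕC
  open import Data.Integer using (ℤ; +_; _+_; _-_; _*_; -_; ∣_∣; 0ℤ; 1ℤ)
  open import Data.Integer.Properties
  import Data.Integer.DivMod as ℤDM
  import Data.Integer.Divisibility.Signed as S
  open import Data.Integer.Divisibility.Signed using (divides)
  open import Data.Integer.Tactic.RingSolver using (solve-∀)
  open import Data.Product using (_,_)
  open import Data.Empty using (⊥-elim)
  open import Relation.Nullary using (¬_; Dec; yes; no)
  open import Relation.Binary.PropositionalEquality
  open import Relation.Binary.Definitions using (tri<; tri≈; tri>)
  open FiniteSums using (∑<; ∑<-cong; ∑<-≡0; ∑<-𝟙-≟; 𝟙; 𝟙-yes; 𝟙-no; 𝟙-⇔)

  infix 4 _∣ᶻ_ _∣ᶻ?_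

  _∣ᶻ_ : ℕ → ℤ → Set
  n ∣ᶻ x = + n S.∣ x

  _∣ᶻ?_ : ∀ n x → Dec (n ∣ᶻ x)
  n ∣ᶻ? x = + n S.∣? x

  ∣ᶻ-self : ∀ n → n ∣ᶻ + n
  ∣ᶻ-self n = S.∣-refl

  ∣ᶻ-0 : ∀ n → n ∣ᶻ 0ℤ
  ∣ᶻ-0 n = divides 0ℤ refl

  ∣ᶻ-weaken : ∀ {m n x} → m ℕD.∣ n → n ∣ᶻ x → m ∣ᶻ x
  ∣ᶻ-weaken m∣n = S.∣-trans (S.∣ᵤ⇒∣ m∣n)

  ∣ᶻ-*-mono : ∀ {m n x y} → m ∣ᶻ x → n ∣ᶻ y → m ℕ.* n ∣ᶻ x * y
  ∣ᶻ-*-mono {m} {n} (divides q e) (divides r f) =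
    divides (q * r) (trans (cong₂ _*_ e f) (trans (regroup q (+ m) r (+ n)) (cong (q * r *_) (sym (pos-* m n)))))
    where
    regroup : ∀ q m r n → (q * m) * (r * n) ≡ (q * r) * (m * n)
    regroup = solve-∀

  ∣ᶻ-*-cancelʳ : ∀ m n x → .{{ℕ.NonZero n}} → m ℕ.* n ∣ᶻ x * + n → m ∣ᶻ x
  ∣ᶻ-*-cancelʳ m n@(suc _) x mn∣xn = S.*-cancelʳ-∣ (+ n) (subst (S._∣ x * + n) (pos-* m n) mn∣xn)

  ^-∣-^ : ∀ p {i j} → i ℕ.≤ j → p ℕ.^ i ℕD.∣ p ℕ.^ j
  ^-∣-^ p {i} {j} i≤j = ℕD.divides (p ℕ.^ (j ℕ.∸ i))
    (trans (cong (p ℕ.^_) (sym (ℕP.m+[n∸m]≡n i≤j))) (trans (ℕP.^-distribˡ-+-* p i (j ℕ.∸ i)) (ℕP.*-comm (p ℕ.^ i) _)))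

  residue-unique : ∀ {n r s} → r ℕ.< n → s ℕ.< n → n ∣ᶻ + r - + s → r ≡ s
  residue-unique {n} {r} {s} r<n s<n n∣r-s with ℕP.<-cmp r s
  ... | tri≈ _ r≡s _ = r≡s
  ... | tri< r<s _ _ = ⊥-elim (ℕP.<⇒≱ (ℕP.≤-<-trans (ℕP.m∸n≤m s r) s<n)
    (ℕD.∣⇒≤ ⦃ ℕ.>-nonZero (ℕP.m<n⇒0<n∸m r<s) ⦄ n∣s∸r))
    where
    n∣s∸r : n ℕD.∣ s ℕ.∸ r
    n∣s∸r = subst (n ℕD.∣_) (trans (cong ∣_∣ (m-n≡m⊖n r s)) (∣⊖∣-≤ (ℕP.<⇒≤ r<s))) (S.∣⇒∣ᵤ n∣r-s)
  ... | tri> _ _ s<r = ⊥-elim (ℕP.<⇒≱ (ℕP.≤-<-trans (ℕP.m∸n≤m r s) r<n)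
    (ℕD.∣⇒≤ ⦃ ℕ.>-nonZero (ℕP.m<n⇒0<n∸m s<r) ⦄ n∣r∸s))
    where
    n∣r∸s : n ℕD.∣ r ℕ.∸ s
    n∣r∸s = subst (n ℕD.∣_) (trans (cong ∣_∣ (m-n≡m⊖n r s)) (trans (∣m⊖n∣≡∣n⊖m∣ r s) (∣⊖∣-≤ (ℕP.<⇒≤ s<r))))
      (S.∣⇒∣ᵤ n∣r-s)

  modN-< : ∀ e n → .{{ℕ.NonZero n}} → modN e n ℕ.< n
  modN-< e (suc n) = ℤDM.n%ℕd<d e (suc n)

  ∣ᶻ-modN : ∀ e n → .{{ℕ.NonZero n}} → n ∣ᶻ e - + modN e n
  ∣ᶻ-modN e n@(suc _) = divides q (trans (cong (_- r) (ℤDM.a≡a%ℕn+[a/ℕn]*n e n)) (cancel r q (+ n)))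
    where
    r = + (e ℤDM.%ℕ n)
    q = e ℤDM./ℕ n
    cancel : ∀ r q d → r + q * d - r ≡ q * d
    cancel = solve-∀

  modN-unique : ∀ {e n r} → r ℕ.< n → n ∣ᶻ e - + r → modN e n ≡ r
  modN-unique {e} {n} {r} r<n n∣e-r =
    residue-unique (modN-< e n) r<n (subst (_ ∣ᶻ_) (difference e (+ modN e n) (+ r)) (S.∣m∣n⇒∣m-n n∣e-r (∣ᶻ-modN e n)))
    where
    instance _ = ℕ.>-nonZero (ℕP.m<n⇒0<n r<n)
    difference : ∀ e s r → (e - r) - (e - s) ≡ s - r
    difference = solve-∀

  modN-cong : ∀ n e e′ → n ∣ᶻ e - e′ → modN e n ≡ modN e′ n
  modN-cong zero e e′ _ = refl
  modN-cong n@(suc _) e e′ n∣e-e′ =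
    modN-unique {e} (modN-< e′ n) (subst (_ ∣ᶻ_) (telescope e e′ (+ modN e′ n)) (S.∣m∣n⇒∣m+n n∣e-e′ (∣ᶻ-modN e′ n)))
    where
    telescope : ∀ x y z → (x - y) + (y - z) ≡ x - z
    telescope = solve-∀

  residue-inverse : ∀ {Q} u v s → s ℕ.< Q → Q ∣ᶻ u * v - 1ℤ → modN (+ modN (+ s * v) Q * u) Q ≡ s
  residue-inverse {Q} u v s s<Q Q∣uv-1 = modN-unique s<Q (subst (_ ∣ᶻ_) (combine u v (+ s) (+ y))
    (S.∣m∣n⇒∣m+n (S.∣m⇒∣m*n (- u) (∣ᶻ-modN (+ s * v) Q)) (S.∣n⇒∣m*n (+ s) Q∣uv-1)))
    where
    instance _ = ℕ.>-nonZero (ℕP.m<n⇒0<n s<Q)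
    y = modN (+ s * v) Q
    combine : ∀ u v s y → (s * v - y) * (- u) + s * (u * v - 1ℤ) ≡ y * u - s
    combine = solve-∀

  modN≡0⇒∣ᶻ : ∀ e n → .{{ℕ.NonZero n}} → modN e n ≡ 0 → n ∣ᶻ e
  modN≡0⇒∣ᶻ e n eq = subst (n ∣ᶻ_) (+-identityʳ e) (subst (λ r → n ∣ᶻ e - + r) eq (∣ᶻ-modN e n))

  ∣ᶻ⇒modN≡0 : ∀ e n → .{{ℕ.NonZero n}} → n ∣ᶻ e → modN e n ≡ 0
  ∣ᶻ⇒modN≡0 e n n∣e = modN-unique (ℕ.>-nonZero⁻¹ n) (subst (n ∣ᶻ_) (sym (+-identityʳ e)) n∣e)

  modN-match : ∀ {n} e r c → r ℕ.< n → (if modN e n ≡ᵇ r then c else 0ℤ) ≡ 𝟙 (n ∣ᶻ? e - + r) * c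
  modN-match {n} e r c r<n with modN e n ≡ᵇ r in test
  ... | true = sym (trans (cong (_* c) (𝟙-yes (n ∣ᶻ? e - + r) n∣e-r)) (*-identityˡ c))
    where
    instance _ = ℕ.>-nonZero (ℕP.m<n⇒0<n r<n)
    n∣e-r : n ∣ᶻ e - + r
    n∣e-r = subst (λ s → n ∣ᶻ e - + s) (ℕP.≡ᵇ⇒≡ (modN e n) r (subst T (sym test) _)) (∣ᶻ-modN e n)
  ... | false = sym (trans (cong (_* c) (𝟙-no (n ∣ᶻ? e - + r) n∤e-r)) (*-zeroˡ c))
    where
    n∤e-r : ¬ n ∣ᶻ e - + r
    n∤e-r n∣e-r = subst T test (ℕP.≡⇒≡ᵇ (modN e n) r (modN-unique r<n n∣e-r))

  coprime-* : ∀ {m x y} → ℕC.Coprime m x → ℕC.Coprime m y → ℕC.Coprime m (x ℕ.* y)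
  coprime-* {x = x} m⊥x m⊥y {d} (d∣m , d∣xy) = m⊥y (d∣m , ℕC.coprime-divisor d⊥x d∣xy)
    where
    d⊥x : ℕC.Coprime d x
    d⊥x (e∣d , e∣x) = m⊥x (ℕD.∣-trans e∣d d∣m , e∣x)

  ∑<-𝟙-∣-shifts : ∀ p N e → .{{ℕ.NonZero p}} → .{{ℕ.NonZero N}} →
    ∑< p (λ i → 𝟙 (p ℕ.* N ∣ᶻ? e - + (i ℕ.* N))) ≡ 𝟙 (N ∣ᶻ? e)
  ∑<-𝟙-∣-shifts p N e with N ∣ᶻ? e
  ... | no N∤e = trans (∑<-≡0 p _ λ i _ → 𝟙-no (p ℕ.* N ∣ᶻ? e - + (i ℕ.* N)) λ pN∣e-iN →
    N∤e (subst (_ ∣ᶻ_) (cancel e (+ (i ℕ.* N)))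
      (S.∣m∣n⇒∣m+n (∣ᶻ-weaken (ℕD.n∣m*n p) pN∣e-iN) (S.∣ᵤ⇒∣ (ℕD.n∣m*n i)))))
    (sym (𝟙-no (N ∣ᶻ? e) N∤e))
    where
    cancel : ∀ e x → e - x + x ≡ e
    cancel = solve-∀
  ... | yes N∣e@(divides s e≡sN) = trans (∑<-cong p only-i₀) (trans (∑<-𝟙-≟ p i₀ (modN-< s p)) (sym (𝟙-yes (N ∣ᶻ? e) N∣e)))
    where
    i₀ = modN s p
    e-iN : ∀ i → e - + (i ℕ.* N) ≡ (s - + i) * + N
    e-iN i = trans (cong₂ _-_ e≡sN (pos-* i N)) (collect s (+ i) (+ N))
      where
      collect : ∀ s i N → s * N - i * N ≡ (s - i) * N
      collect = solve-∀
    only-i₀ : ∀ i → i ℕ.< p → 𝟙 (p ℕ.* N ∣ᶻ? e - + (i ℕ.* N)) ≡ 𝟙 (i ℕ.≟ i₀)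
    only-i₀ i i<p = 𝟙-⇔ (p ℕ.* N ∣ᶻ? e - + (i ℕ.* N)) (i ℕ.≟ i₀) to from
      where
      difference : ∀ s i j → (s - j) - (s - i) ≡ i - j
      difference = solve-∀
      to : p ℕ.* N ∣ᶻ e - + (i ℕ.* N) → i ≡ i₀
      to pN∣e-iN = residue-unique i<p (modN-< s p) (subst (_ ∣ᶻ_) (difference s (+ i) (+ i₀))
        (S.∣m∣n⇒∣m-n (∣ᶻ-modN s p) (∣ᶻ-*-cancelʳ p N (s - + i) (subst (_ ∣ᶻ_) (e-iN i) pN∣e-iN))))
      from : i ≡ i₀ → p ℕ.* N ∣ᶻ e - + (i ℕ.* N)
      from refl = subst (_ ∣ᶻ_) (sym (e-iN i)) (∣ᶻ-*-mono (∣ᶻ-modN s p) (∣ᶻ-self N))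

module PrimePowerResidues where

  open import Data.Nat as ℕ using (ℕ; zero; suc)
  import Data.Nat.Properties as ℕP
  import Data.Nat.Divisibility as ℕD
  import Data.Nat.Coprimality as ℕC
  import Data.Nat.GCD as ℕG
  open import Data.Nat.Induction using (<-wellFounded)
  open import Data.Nat.Primality using (Prime; euclidsLemma; prime⇒irreducible; prime⇒nonZero; prime⇒nonTrivial)
  open import Data.Integer using (ℤ; +_; -[1+_]; _+_; _-_; _*_; -_; ∣_∣; 1ℤ)
  open import Data.Integer.Properties
  import Data.Integer.Divisibility.Signed as S
  open import Data.Integer.Divisibility.Signed using (divides)
  open import Data.Integer.Tactic.RingSolver using (solve-∀)
  open import Data.Product using (Σ; _×_; _,_; proj₁; proj₂)
  open import Data.Sum using (_⊎_; inj₁; inj₂)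
  open import Relation.Nullary using (¬_; yes; no; contradiction)
  open import Relation.Binary.PropositionalEquality
  open ≡-Reasoning
  open import Function using (_∘_)
  open import Induction.WellFounded using (Acc; acc)
  open FiniteSums
  open IntegerDivisibility

  square≡square-abs : ∀ w → w * w ≡ + ∣ w ∣ * + ∣ w ∣
  square≡square-abs (+ _) = refl
  square≡square-abs -[1+ _ ] = refl

  module _ {p} (pr : Prime p) where

    private instance
      p≢0 : ℕ.NonZero p
      p≢0 = prime⇒nonZero pr

    ¬∣⇒coprime-^ : ∀ {m} → ¬ p ℕD.∣ m → ∀ i → ℕC.Coprime m (p ℕ.^ i)
    ¬∣⇒coprime-^ p∤m zero (_ , d∣1) = ℕD.∣1⇒≡1 d∣1
    ¬∣⇒coprime-^ {m} p∤m (suc i) = coprime-* m⊥p (¬∣⇒coprime-^ p∤m i)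
      where
      m⊥p : ℕC.Coprime m p
      m⊥p (d∣m , d∣p) with prime⇒irreducible pr d∣p
      ... | inj₁ d≡1 = d≡1
      ... | inj₂ refl = contradiction d∣m p∤m

    coprime⇒¬∣ : ∀ {x q} → p ℕD.∣ q → ℕC.Coprime x q → ¬ p ℕD.∣ x
    coprime⇒¬∣ p∣q x⊥q p∣x = ℕ.nonTrivial⇒≢1 ⦃ prime⇒nonTrivial pr ⦄ (x⊥q (p∣x , p∣q))

    ∣ᶻ-euclid : ∀ x y → p ∣ᶻ x * y → p ∣ᶻ x ⊎ p ∣ᶻ y
    ∣ᶻ-euclid x y p∣xy with euclidsLemma ∣ x ∣ ∣ y ∣ pr (subst (_ ℕD.∣_) (abs-* x y) (S.∣⇒∣ᵤ p∣xy))
    ... | inj₁ p∣x = inj₁ (S.∣ᵤ⇒∣ p∣x)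
    ... | inj₂ p∣y = inj₂ (S.∣ᵤ⇒∣ p∣y)

    ∣ᶻ-cancel-unit : ∀ i w x → ¬ p ∣ᶻ w → p ℕ.^ i ∣ᶻ w * x → p ℕ.^ i ∣ᶻ x
    ∣ᶻ-cancel-unit i w x p∤w pⁱ∣wx = S.∣ᵤ⇒∣ (ℕC.coprime-divisor
      (ℕC.sym (¬∣⇒coprime-^ (p∤w ∘ S.∣ᵤ⇒∣) i)) (subst (_ ℕD.∣_) (abs-* w x) (S.∣⇒∣ᵤ pⁱ∣wx)))

    ℕ-inverse : ∀ i m → ¬ p ℕD.∣ m → Σ ℤ λ v → p ℕ.^ i ∣ᶻ + m * v - 1ℤ
    ℕ-inverse i m p∤m with ℕC.coprime-Bézout (¬∣⇒coprime-^ p∤m i)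
    ... | ℕG.Bézout.+- x y eq = + x , divides (+ y) (begin
      + m * + x - 1ℤ          ≡⟨ cong (_- 1ℤ) (trans (*-comm (+ m) (+ x)) (sym (pos-* x m))) ⟩
      + (x ℕ.* m) - 1ℤ        ≡⟨ cong (λ z → + z - 1ℤ) (sym eq) ⟩
      + (1 ℕ.+ y ℕ.* P) - 1ℤ  ≡⟨ cong (_- 1ℤ) (trans (pos-+ 1 (y ℕ.* P)) (cong (_+_ 1ℤ) (pos-* y P))) ⟩
      1ℤ + + y * + P - 1ℤ     ≡⟨ cancel (+ y * + P) ⟩
      + y * + P               ∎)
      where
      P = p ℕ.^ i
      cancel : ∀ z → 1ℤ + z - 1ℤ ≡ z
      cancel = solve-∀
    ... | ℕG.Bézout.-+ x y eq = - + x , divides (- + y) (begin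
      + m * - + x - 1ℤ
        ≡⟨ negate (+ m) (+ x) ⟩
      - (1ℤ + + x * + m)
        ≡⟨ cong -_ (trans (cong (_+_ 1ℤ) (sym (pos-* x m))) (sym (pos-+ 1 (x ℕ.* m)))) ⟩
      - + (1 ℕ.+ x ℕ.* m)
        ≡⟨ cong (λ z → - + z) eq ⟩
      - + (y ℕ.* P)
        ≡⟨ trans (cong -_ (pos-* y P)) (neg-distribˡ-* (+ y) (+ P)) ⟩
      - + y * + P ∎)
      where
      P = p ℕ.^ i
      negate : ∀ m x → m * - x - 1ℤ ≡ - (1ℤ + x * m)
      negate = solve-∀

    -- If ∣w∣ v ≡ 1, then w (w v²) = (∣w∣ v)² ≡ 1, avoiding a case split on the sign of w.
    unit-inverse : ∀ i w → ¬ p ∣ᶻ w → Σ ℤ λ w′ → p ℕ.^ i ∣ᶻ w * w′ - 1ℤ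
    unit-inverse i w p∤w with ℕ-inverse i ∣ w ∣ (p∤w ∘ S.∣ᵤ⇒∣)
    ... | v , pⁱ∣∣w∣v-1 = w * v * v , subst (_ ∣ᶻ_) (sym factor) (S.∣m⇒∣m*n (+ ∣ w ∣ * v + 1ℤ) pⁱ∣∣w∣v-1)
      where
      a = + ∣ w ∣
      factor : w * (w * v * v) - 1ℤ ≡ (a * v - 1ℤ) * (a * v + 1ℤ)
      factor = begin
        w * (w * v * v) - 1ℤ        ≡⟨ regroup w v ⟩
        (w * w) * (v * v) - 1ℤ      ≡⟨ cong (λ s → s * (v * v) - 1ℤ) (square≡square-abs w) ⟩
        (a * a) * (v * v) - 1ℤ      ≡⟨ difference-of-squares a v ⟩
        (a * v - 1ℤ) * (a * v + 1ℤ) ∎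
        where
        regroup : ∀ w v → w * (w * v * v) - 1ℤ ≡ (w * w) * (v * v) - 1ℤ
        regroup = solve-∀
        difference-of-squares : ∀ a v → (a * a) * (v * v) - 1ℤ ≡ (a * v - 1ℤ) * (a * v + 1ℤ)
        difference-of-squares = solve-∀

    p-power-split : ∀ x → .{{ℕ.NonZero x}} →
      Σ ℕ λ v → Σ ℕ λ u → x ≡ p ℕ.^ v ℕ.* u × ¬ p ℕD.∣ u
    p-power-split x = split x (<-wellFounded x)
      where
      split : ∀ x → .{{ℕ.NonZero x}} → Acc ℕ._<_ x → Σ ℕ λ v → Σ ℕ λ u → x ≡ p ℕ.^ v ℕ.* u × ¬ p ℕD.∣ u
      split x (acc smaller) with p ℕD.∣? x
      ... | no p∤x = 0 , x , sym (ℕP.+-identityʳ x) , p∤x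
      ... | yes (ℕD.divides y refl) with split y ⦃ y≢0 ⦄
          (smaller (ℕP.m<m*n y p ⦃ y≢0 ⦄ (ℕ.nonTrivial⇒n>1 p ⦃ prime⇒nonTrivial pr ⦄)))
        where
        y≢0 : ℕ.NonZero y
        y≢0 = ℕP.m*n≢0⇒m≢0 y
      ...   | v , u , refl , p∤u = suc v , u , reassociate , p∤u
        where
        reassociate : p ℕ.^ v ℕ.* u ℕ.* p ≡ p ℕ.* p ℕ.^ v ℕ.* u
        reassociate = trans (ℕP.*-comm (p ℕ.^ v ℕ.* u) p) (sym (ℕP.*-assoc p (p ℕ.^ v) u))

    p∤1 : ¬ p ∣ᶻ 1ℤ
    p∤1 p∣1 = ℕ.nonTrivial⇒≢1 ⦃ prime⇒nonTrivial pr ⦄ (ℕD.∣1⇒≡1 (S.∣⇒∣ᵤ p∣1))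

    ∑<-reindex-by-unit : ∀ i w → ¬ p ∣ᶻ w → ∀ g →
      ∑< (p ℕ.^ i) (λ t → g (modN (+ t * w) (p ℕ.^ i))) ≡ ∑< (p ℕ.^ i) g
    ∑<-reindex-by-unit i w p∤w g = ∑<-reindex Q φ ψ g (λ t _ → modN-< _ Q) (λ s _ → modN-< _ Q) φψ ψφ
      where
      Q = p ℕ.^ i
      instance _ = ℕP.m^n≢0 p i
      w′ = proj₁ (unit-inverse i w p∤w)
      Q∣ww′-1 : Q ∣ᶻ w * w′ - 1ℤ
      Q∣ww′-1 = proj₂ (unit-inverse i w p∤w)
      φ ψ : ℕ → ℕ
      φ t = modN (+ t * w) Q
      ψ s = modN (+ s * w′) Q
      φψ : ∀ s → s ℕ.< Q → φ (ψ s) ≡ s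
      φψ s s<Q = residue-inverse w w′ s s<Q Q∣ww′-1
      ψφ : ∀ t → t ℕ.< Q → ψ (φ t) ≡ t
      ψφ t t<Q = residue-inverse w′ w t t<Q (subst (λ z → Q ∣ᶻ z - 1ℤ) (*-comm w w′) Q∣ww′-1)

    -- If ρ ≡ r (mod p^M) and p^M ∤ ρ, then r and ρ have the same p-adic valuation v < M,
    -- so r = p^v R and ρ = p^v u with R, u units, and w = R u⁻¹ works.
    unit-multiple : ∀ M k {r ρ} → ¬ p ℕ.^ M ∣ᶻ + ρ → p ℕ.^ M ∣ᶻ + r - + ρ →
      Σ ℤ λ w → ¬ p ∣ᶻ w × p ℕ.^ k ∣ᶻ + r - w * + ρ
    unit-multiple M k {r} {ρ} pᴹ∤ρ (S.divides s r-ρ≡sN) with p-power-split ρ ⦃ ρ≢0 ⦄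
      where
      ρ≢0 : ℕ.NonZero ρ
      ρ≢0 = ℕ.≢-nonZero λ { refl → pᴹ∤ρ (∣ᶻ-0 _) }
    ... | v , u , refl , p∤u = R * u⁻¹ , p∤Ru⁻¹ , pᵏ∣r-Ru⁻¹ρ
      where
      v<M : v ℕ.< M
      v<M = ℕP.≰⇒> λ M≤v → pᴹ∤ρ (S.∣ᵤ⇒∣ (ℕD.∣-trans (^-∣-^ p M≤v) (ℕD.m∣m*n u)))
      e = M ℕ.∸ v
      P = + (p ℕ.^ v)
      R = + u + s * + (p ℕ.^ e)
      pᴹ≡pᵛpᵉ : + (p ℕ.^ M) ≡ P * + (p ℕ.^ e)
      pᴹ≡pᵛpᵉ = trans (cong (λ x → + (p ℕ.^ x)) (sym (ℕP.m+[n∸m]≡n (ℕP.<⇒≤ v<M))))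
                      (trans (cong +_ (ℕP.^-distribˡ-+-* p v e)) (pos-* (p ℕ.^ v) (p ℕ.^ e)))
      r≡PR : + r ≡ P * R
      r≡PR = begin
        + r                                    ≡⟨ split (+ r) (+ (p ℕ.^ v ℕ.* u)) ⟩
        (+ r - + (p ℕ.^ v ℕ.* u)) + + (p ℕ.^ v ℕ.* u) ≡⟨ cong₂ _+_ r-ρ≡sN (pos-* (p ℕ.^ v) u) ⟩
        s * + (p ℕ.^ M) + P * + u              ≡⟨ cong (λ x → s * x + P * + u) pᴹ≡pᵛpᵉ ⟩
        s * (P * + (p ℕ.^ e)) + P * + u        ≡⟨ collect s P (+ (p ℕ.^ e)) (+ u) ⟩
        P * R                                  ∎
        where
        split : ∀ r ρ → r ≡ (r - ρ) + ρ
        split = solve-∀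
        collect : ∀ s P E u → s * (P * E) + P * u ≡ P * (u + s * E)
        collect = solve-∀
      p∤R : ¬ p ∣ᶻ R
      p∤R p∣R = p∤u (S.∣⇒∣ᵤ (subst (_ ∣ᶻ_) (cancel (+ u) (s * + (p ℕ.^ e)))
        (S.∣m∣n⇒∣m-n p∣R (S.∣n⇒∣m*n s (S.∣ᵤ⇒∣ (subst (ℕD._∣ p ℕ.^ e) (ℕP.*-identityʳ p)
          (^-∣-^ p (ℕP.m<n⇒0<n∸m v<M))))))))
        where
        cancel : ∀ x y → x + y - y ≡ x
        cancel = solve-∀
      u⁻¹ = proj₁ (unit-inverse (suc k) (+ u) (p∤u ∘ S.∣⇒∣ᵤ))
      p¹⁺ᵏ∣uu⁻¹-1 : p ℕ.^ suc k ∣ᶻ + u * u⁻¹ - 1ℤ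
      p¹⁺ᵏ∣uu⁻¹-1 = proj₂ (unit-inverse (suc k) (+ u) (p∤u ∘ S.∣⇒∣ᵤ))
      p∤Ru⁻¹ : ¬ p ∣ᶻ R * u⁻¹
      p∤Ru⁻¹ p∣Ru⁻¹ with ∣ᶻ-euclid R u⁻¹ p∣Ru⁻¹
      ... | inj₁ p∣R = p∤R p∣R
      ... | inj₂ p∣u⁻¹ = p∤1 (subst (_ ∣ᶻ_) (cancel (+ u) u⁻¹)
        (S.∣m∣n⇒∣m-n (S.∣n⇒∣m*n (+ u) p∣u⁻¹) (∣ᶻ-weaken (ℕD.m∣m*n (p ℕ.^ k)) p¹⁺ᵏ∣uu⁻¹-1)))
        where
        cancel : ∀ x i → x * i - (x * i - 1ℤ) ≡ 1ℤ
        cancel = solve-∀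
      pᵏ∣r-Ru⁻¹ρ : p ℕ.^ k ∣ᶻ + r - R * u⁻¹ * + ρ
      pᵏ∣r-Ru⁻¹ρ = subst (_ ∣ᶻ_) (sym (trans (cong₂ (λ x y → x - R * u⁻¹ * y) r≡PR (pos-* (p ℕ.^ v) u))
          (factor P R u⁻¹ (+ u))))
        (S.∣n⇒∣m*n (- (P * R)) (∣ᶻ-weaken (^-∣-^ p (ℕP.n≤1+n k)) p¹⁺ᵏ∣uu⁻¹-1))
        where
        factor : ∀ P R i u → P * R - R * i * (P * u) ≡ - (P * R) * (u * i - 1ℤ)
        factor = solve-∀

    𝟙-coprime-^ : ∀ i t → 𝟙 (ℕC.coprime? t (p ℕ.^ suc i)) ≡ 1ℤ + - 1ℤ * 𝟙 (p ℕD.∣? t)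
    𝟙-coprime-^ i t with p ℕD.∣? t
    ... | yes p∣t = 𝟙-no (ℕC.coprime? t _) (λ t⊥pⁱ⁺¹ → coprime⇒¬∣ (ℕD.m∣m*n (p ℕ.^ i)) t⊥pⁱ⁺¹ p∣t)
    ... | no p∤t = 𝟙-yes (ℕC.coprime? t _) (¬∣⇒coprime-^ p∤t (suc i))

    𝟙-coprime-unit-multiple : ∀ i w t → ¬ p ∣ᶻ w →
      𝟙 (ℕC.coprime? (modN (+ t * w) (p ℕ.^ suc i)) (p ℕ.^ suc i)) ≡ 𝟙 (ℕC.coprime? t (p ℕ.^ suc i))
    𝟙-coprime-unit-multiple i w t p∤w = begin
      𝟙 (ℕC.coprime? s Q)                 ≡⟨ 𝟙-coprime-^ i s ⟩
      1ℤ + - 1ℤ * 𝟙 (p ℕD.∣? s)           ≡⟨ cong (λ x → 1ℤ + - 1ℤ * x) (𝟙-⇔ (p ℕD.∣? s) (p ℕD.∣? t) to from) ⟩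
      1ℤ + - 1ℤ * 𝟙 (p ℕD.∣? t)           ≡⟨ sym (𝟙-coprime-^ i t) ⟩
      𝟙 (ℕC.coprime? t Q)                 ∎
      where
      Q = p ℕ.^ suc i
      instance _ = ℕP.m^n≢0 p (suc i)
      s = modN (+ t * w) Q
      p∣tw-s : p ∣ᶻ + t * w - + s
      p∣tw-s = ∣ᶻ-weaken (ℕD.m∣m*n (p ℕ.^ i)) (∣ᶻ-modN (+ t * w) Q)
      cancel : ∀ x y → x - y + y ≡ x
      cancel = solve-∀
      to : p ℕD.∣ s → p ℕD.∣ t
      to p∣s with ∣ᶻ-euclid (+ t) w (subst (_ ∣ᶻ_) (cancel (+ t * w) (+ s)) (S.∣m∣n⇒∣m+n p∣tw-s (S.∣ᵤ⇒∣ p∣s)))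
      ... | inj₁ p∣t = S.∣⇒∣ᵤ p∣t
      ... | inj₂ p∣w = contradiction p∣w p∤w
      cancel′ : ∀ x y → x - (x - y) ≡ y
      cancel′ = solve-∀
      from : p ℕD.∣ t → p ℕD.∣ s
      from p∣t = S.∣⇒∣ᵤ (subst (_ ∣ᶻ_) (cancel′ (+ t * w) (+ s))
        (S.∣m∣n⇒∣m-n (S.∣m⇒∣m*n {m = + t} w (S.∣ᵤ⇒∣ p∣t)) p∣tw-s))

    totient-^ : ∀ i → ∑< (p ℕ.^ suc i) (λ t → 𝟙 (ℕC.coprime? t (p ℕ.^ suc i))) ≡ + (p ℕ.^ i) * (+ p - 1ℤ)
    totient-^ i = begin
      ∑< Q (λ t → 𝟙 (ℕC.coprime? t Q))
        ≡⟨ ∑<-cong Q (λ t _ → 𝟙-coprime-^ i t) ⟩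
      ∑< Q (λ t → 1ℤ + - 1ℤ * 𝟙 (p ℕD.∣? t))
        ≡⟨ ∑<-+ Q _ _ ⟩
      ∑< Q (λ _ → 1ℤ) + ∑< Q (λ t → - 1ℤ * 𝟙 (p ℕD.∣? t))
        ≡⟨ cong₂ _+_ (∑<-const Q 1ℤ) (∑<-*ˡ Q (- 1ℤ) _) ⟩
      + Q * 1ℤ + - 1ℤ * ∑< Q (λ t → 𝟙 (p ℕD.∣? t))
        ≡⟨ cong (λ x → + Q * 1ℤ + - 1ℤ * x) multiples ⟩
      + Q * 1ℤ + - 1ℤ * + (p ℕ.^ i)
        ≡⟨ cong (λ x → x * 1ℤ + - 1ℤ * + (p ℕ.^ i)) (pos-* p (p ℕ.^ i)) ⟩
      + p * + (p ℕ.^ i) * 1ℤ + - 1ℤ * + (p ℕ.^ i)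
        ≡⟨ collect (+ p) (+ (p ℕ.^ i)) ⟩
      + (p ℕ.^ i) * (+ p - 1ℤ) ∎
      where
      Q = p ℕ.^ suc i
      multiples : ∑< Q (λ t → 𝟙 (p ℕD.∣? t)) ≡ + (p ℕ.^ i)
      multiples = trans (cong (λ x → ∑< x (λ t → 𝟙 (p ℕD.∣? t))) (ℕP.*-comm p (p ℕ.^ i))) (count-multiples (p ℕ.^ i) p)
      collect : ∀ p P → p * P * 1ℤ + - 1ℤ * P ≡ P * (p - 1ℤ)
      collect = solve-∀

    ∑<-units : ∀ i (X : ℕ → ℤ) Y → (∀ t → ¬ p ℕD.∣ t → X t ≡ Y) →
      ∑< (p ℕ.^ suc i) (λ t → 𝟙 (ℕC.coprime? t (p ℕ.^ suc i)) * X t) ≡ + (p ℕ.^ i) * (+ p - 1ℤ) * Y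
    ∑<-units i X Y const-on-units = begin
      ∑< Q (λ t → 𝟙 (ℕC.coprime? t Q) * X t) ≡⟨ ∑<-cong Q (λ t _ → on-unit t) ⟩
      ∑< Q (λ t → Y * 𝟙 (ℕC.coprime? t Q))   ≡⟨ ∑<-*ˡ Q Y _ ⟩
      Y * ∑< Q (λ t → 𝟙 (ℕC.coprime? t Q))   ≡⟨ trans (*-comm Y _) (cong (_* Y) (totient-^ i)) ⟩
      + (p ℕ.^ i) * (+ p - 1ℤ) * Y           ∎
      where
      Q = p ℕ.^ suc i
      on-unit : ∀ t → 𝟙 (ℕC.coprime? t Q) * X t ≡ Y * 𝟙 (ℕC.coprime? t Q)
      on-unit t with ℕC.coprime? t Q
      ... | yes t⊥Q rewrite 𝟙-yes (ℕC.coprime? t Q) t⊥Q =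
        trans (*-identityˡ (X t)) (trans (const-on-units t (coprime⇒¬∣ (ℕD.m∣m*n (p ℕ.^ i)) t⊥Q)) (sym (*-identityʳ Y)))
      ... | no ¬t⊥Q rewrite 𝟙-no (ℕC.coprime? t Q) ¬t⊥Q = sym (*-zeroʳ Y)

    module _ (k : ℕ) {w x x′ y y′ : ℤ} (p∤w : ¬ p ∣ᶻ w)
             (x′≡wx : p ℕ.^ k ∣ᶻ x′ - w * x) (y′≡wy : p ℕ.^ k ∣ᶻ y′ - w * y) where

      ∣ᶻ-unit-scale⁻ : p ℕ.^ k ∣ᶻ x′ - y′ → p ℕ.^ k ∣ᶻ x - y
      ∣ᶻ-unit-scale⁻ pᵏ∣x′-y′ = ∣ᶻ-cancel-unit k w (x - y) p∤w
        (subst (_ ∣ᶻ_) (combine x′ y′ w x y) (S.∣m∣n⇒∣m+n (S.∣m∣n⇒∣m-n pᵏ∣x′-y′ x′≡wx) y′≡wy))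
        where
        combine : ∀ x′ y′ w x y → (x′ - y′) - (x′ - w * x) + (y′ - w * y) ≡ w * (x - y)
        combine = solve-∀

      ∣ᶻ-unit-scale⁺ : p ℕ.^ k ∣ᶻ x - y → p ℕ.^ k ∣ᶻ x′ - y′
      ∣ᶻ-unit-scale⁺ pᵏ∣x-y = subst (_ ∣ᶻ_) (combine x′ y′ w x y)
        (S.∣m∣n⇒∣m+n (S.∣m∣n⇒∣m-n x′≡wx y′≡wy) (S.∣n⇒∣m*n w pᵏ∣x-y))
        where
        combine : ∀ x′ y′ w x y → (x′ - w * x) - (y′ - w * y) + w * (x - y) ≡ x′ - y′
        combine = solve-∀

    module _ (e τ t : ℕ) (z : ℤ) (p∤t : ¬ p ℕD.∣ t) where

      p^[e+τ]∣t*p^τ*z⇒p^e∣z : p ℕ.^ (e ℕ.+ τ) ∣ᶻ + t * (+ (p ℕ.^ τ) * z) → p ℕ.^ e ∣ᶻ z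
      p^[e+τ]∣t*p^τ*z⇒p^e∣z p^[e+τ]∣ = ∣ᶻ-*-cancelʳ (p ℕ.^ e) (p ℕ.^ τ) z ⦃ ℕP.m^n≢0 p τ ⦄
        (subst₂ _∣ᶻ_ (ℕP.^-distribˡ-+-* p e τ) (*-comm (+ (p ℕ.^ τ)) z)
          (∣ᶻ-cancel-unit (e ℕ.+ τ) (+ t) _ (p∤t ∘ S.∣⇒∣ᵤ) p^[e+τ]∣))

      p^e∣z⇒p^[e+τ]∣t*p^τ*z : p ℕ.^ e ∣ᶻ z → p ℕ.^ (e ℕ.+ τ) ∣ᶻ + t * (+ (p ℕ.^ τ) * z)
      p^e∣z⇒p^[e+τ]∣t*p^τ*z pᵉ∣z = S.∣n⇒∣m*n (+ t) (subst₂ _∣ᶻ_ (sym (ℕP.^-distribˡ-+-* p e τ)) (*-comm z (+ (p ℕ.^ τ)))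
        (∣ᶻ-*-mono pᵉ∣z (∣ᶻ-self (p ℕ.^ τ))))

module ExponentialSums where

  open import Data.Bool using (if_then_else_)
  open import Data.Nat as ℕ using (ℕ; suc; _≡ᵇ_)
  import Data.Nat.Properties as ℕP
  import Data.Nat.DivMod as ℕDM
  import Data.Nat.Divisibility as ℕD
  open import Data.Integer using (ℤ; +_; _+_; _-_; _*_; -_; 0ℤ; 1ℤ)
  open import Data.Integer.Properties
  import Data.Integer.Divisibility.Signed as S
  open import Data.Integer.Tactic.RingSolver using (solve-∀)
  open import Data.List using ([]; _∷_; _++_; map; concatMap; upTo)
  import Data.List.Properties as ℓP
  open import Data.Product using (_×_; _,_)
  open import Relation.Nullary using (yes; no)
  open import Function using (_∘_)
  open import Relation.Binary.PropositionalEquality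
  open ≡-Reasoning
  open FiniteSums
  open IntegerDivisibility

  private
    shift : ℤ → ℤ → ℤ × ℤ → ℤ × ℤ
    shift c e (d , f) = (c * d , e + f)

  module _ (n : ℕ) where

    coeff-++ : ∀ S T r → coeff n (S ++ T) r ≡ coeff n S r + coeff n T r
    coeff-++ [] T r = sym (+-identityˡ _)
    coeff-++ ((c , e) ∷ S) T r = trans (cong (_+_ x) (coeff-++ S T r)) (sym (+-assoc x (coeff n S r) (coeff n T r)))
      where
      x = if modN e n ≡ᵇ r then c else 0ℤ

    coeff-concatMap : ∀ {A : Set} (f : A → ExpSum) xs r →
      coeff n (concatMap f xs) r ≡ sumℤ (map (λ x → coeff n (f x) r) xs)
    coeff-concatMap f [] r = refl
    coeff-concatMap f (x ∷ xs) r = trans (coeff-++ (f x) (concatMap f xs) r) (cong (_+_ (coeff n (f x) r)) (coeff-concatMap f xs r))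

    coeff-monomials : ∀ m c (e : ℕ → ℤ) r → r ℕ.< n →
      coeff n (map (λ j → (c , e j)) (upTo m)) r ≡ ∑< m (λ j → 𝟙 (n ∣ᶻ? e j - + r) * c)
    coeff-monomials m c e r r<n = begin
      coeff n (map (λ j → (c , e j)) (upTo m)) r
        ≡⟨ cong sumℤ (sym (ℓP.map-∘ (upTo m))) ⟩
      sumℤ (map (λ j → if modN (e j) n ≡ᵇ r then c else 0ℤ) (upTo m))
        ≡⟨ sumℤ-map-upTo m _ ⟩
      ∑< m (λ j → if modN (e j) n ≡ᵇ r then c else 0ℤ)
        ≡⟨ ∑<-cong m (λ j _ → modN-match (e j) r c r<n) ⟩
      ∑< m (λ j → 𝟙 (n ∣ᶻ? e j - + r) * c) ∎

    coeff-const : ∀ c r → r ℕ.< n → coeff n (const c) r ≡ 𝟙 (n ∣ᶻ? 0ℤ - + r) * c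
    coeff-const c r r<n = trans (+-identityʳ _) (modN-match 0ℤ r c r<n)

    coeff-monomial-⊗-gauss : ∀ c e A m r → r ℕ.< n →
      coeff n (((c , e) ∷ []) ⊗ gauss A m) r ≡ ∑< m (λ j → 𝟙 (n ∣ᶻ? e + A * (+ j * + j) - + r) * (c * 1ℤ))
    coeff-monomial-⊗-gauss c e A m r r<n = begin
      coeff n (map (shift c e) (gauss A m) ++ []) r
        ≡⟨ cong (λ S → coeff n S r) (ℓP.++-identityʳ (map (shift c e) (gauss A m))) ⟩
      coeff n (map (shift c e) (gauss A m)) r
        ≡⟨ cong (λ S → coeff n S r) (sym (ℓP.map-∘ (upTo m))) ⟩
      coeff n (map (λ j → (c * 1ℤ , e + A * (+ j * + j))) (upTo m)) r
        ≡⟨ coeff-monomials m (c * 1ℤ) _ r r<n ⟩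
      ∑< m (λ j → 𝟙 (n ∣ᶻ? e + A * (+ j * + j) - + r) * (c * 1ℤ)) ∎

    coeff-⊗-trivial-gauss : ∀ S B m r → n ∣ᶻ B → coeff n (S ⊗ gauss B m) r ≡ + m * coeff n S r
    coeff-⊗-trivial-gauss [] B m r n∣B = sym (*-zeroʳ (+ m))
    coeff-⊗-trivial-gauss ((c , e) ∷ S) B m r n∣B = begin
      coeff n (map (shift c e) (gauss B m) ++ S ⊗ gauss B m) r
        ≡⟨ coeff-++ (map (shift c e) (gauss B m)) (S ⊗ gauss B m) r ⟩
      coeff n (map (shift c e) (gauss B m)) r + coeff n (S ⊗ gauss B m) r
        ≡⟨ cong₂ _+_ first-row (coeff-⊗-trivial-gauss S B m r n∣B) ⟩
      + m * x + + m * coeff n S r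
        ≡⟨ sym (*-distribˡ-+ (+ m) x (coeff n S r)) ⟩
      + m * coeff n ((c , e) ∷ S) r ∎
      where
      x = if modN e n ≡ᵇ r then c else 0ℤ
      shift-vanishes : ∀ j → modN (e + B * (+ j * + j)) n ≡ modN e n
      shift-vanishes j = modN-cong n _ e (subst (_ ∣ᶻ_) (cancel e (B * (+ j * + j))) (S.∣m⇒∣m*n (+ j * + j) n∣B))
        where
        cancel : ∀ e y → y ≡ e + y - e
        cancel = solve-∀
      first-row : coeff n (map (shift c e) (gauss B m)) r ≡ + m * x
      first-row = begin
        coeff n (map (shift c e) (gauss B m)) r ≡⟨ cong (λ S → coeff n S r) (sym (ℓP.map-∘ (upTo m))) ⟩
        coeff n (map (λ j → (c * 1ℤ , e + B * (+ j * + j))) (upTo m)) r ≡⟨ cong sumℤ (sym (ℓP.map-∘ (upTo m))) ⟩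
        sumℤ (map (λ j → if modN (e + B * (+ j * + j)) n ≡ᵇ r then c * 1ℤ else 0ℤ) (upTo m))
                                                                  ≡⟨ sumℤ-map-upTo m _ ⟩
        ∑< m (λ j → if modN (e + B * (+ j * + j)) n ≡ᵇ r then c * 1ℤ else 0ℤ)
                                                                  ≡⟨ ∑<-cong m (λ j _ → cong₂ (λ s y → if s ≡ᵇ r then y else 0ℤ)
                                                                    (shift-vanishes j) (*-identityʳ c)) ⟩
        ∑< m (λ _ → x)                                            ≡⟨ ∑<-const m x ⟩
        + m * x                                                   ∎

  -- Writing r = ρ + qN with ρ < N, q < p: among the p residues of r - jN modulo pN,
  -- only the one for j = q lies below N, and it equals ρ.
  ∑<-window : ∀ p N (g : ℕ → ℤ) → .{{ℕ.NonZero N}} → ∀ r → r ℕ.< p ℕ.* N →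
    ∑< p (λ j → 𝟙 (modN (+ r - + (j ℕ.* N)) (p ℕ.* N) ℕ.<? N) * g (modN (+ r - + (j ℕ.* N)) (p ℕ.* N)))
      ≡ g (modN (+ r) N)
  ∑<-window p N g r r<pN = begin
    ∑< p (λ j → 𝟙 (x j ℕ.<? N) * g (x j)) ≡⟨ ∑<-cong p (λ j j<p → only-q j j<p) ⟩
    ∑< p (λ j → 𝟙 (j ℕ.≟ q) * g ρ)      ≡⟨ ∑<-δ p q (λ _ → g ρ) q<p ⟩
    g ρ                                  ≡⟨ cong g ρ≡modN ⟩
    g (modN (+ r) N)                     ∎
    where
    instance
      pN≢0 : ℕ.NonZero (p ℕ.* N)
      pN≢0 = ℕ.>-nonZero (ℕP.m<n⇒0<n r<pN)
      p≢0 : ℕ.NonZero p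
      p≢0 = ℕP.m*n≢0⇒m≢0 p {N} ⦃ pN≢0 ⦄
    q = r ℕDM./ N
    ρ = r ℕDM.% N
    q<p : q ℕ.< p
    q<p = ℕDM.m<n*o⇒m/o<n r<pN
    ρ<N : ρ ℕ.< N
    ρ<N = ℕDM.m%n<n r N
    x : ℕ → ℕ
    x j = modN (+ r - + (j ℕ.* N)) (p ℕ.* N)
    r≡ : + r ≡ + ρ + + q * + N
    r≡ = trans (cong +_ (ℕDM.m≡m%n+[m/n]*n r N)) (trans (pos-+ ρ (q ℕ.* N)) (cong (_+_ (+ ρ)) (pos-* q N)))
    r-jN : ∀ j → + r - + (j ℕ.* N) ≡ + ρ + (+ q - + j) * + N
    r-jN j = trans (cong₂ _-_ r≡ (pos-* j N)) (collect (+ ρ) (+ q) (+ j) (+ N))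
      where
      collect : ∀ a b c d → a + b * d - c * d ≡ a + (b - c) * d
      collect = solve-∀
    ρ≡modN : ρ ≡ modN (+ r) N
    ρ≡modN = sym (modN-unique ρ<N (S.divides (+ q) (trans (cong (_- + ρ) r≡) (cancel (+ ρ) (+ q * + N)))))
      where
      cancel : ∀ a b → a + b - a ≡ b
      cancel = solve-∀
    x-q : x q ≡ ρ
    x-q = modN-unique (ℕP.<-≤-trans ρ<N (ℕP.m≤n*m N p)) (subst (_ ∣ᶻ_) (sym vanish) (∣ᶻ-0 _))
      where
      cancel : ∀ a b d → a + (b - b) * d - a ≡ 0ℤ
      cancel = solve-∀
      vanish : + r - + (q ℕ.* N) - + ρ ≡ 0ℤ
      vanish = trans (cong (_- + ρ) (r-jN q)) (cancel (+ ρ) (+ q) (+ N))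
    x<N⇒j≡q : ∀ j → j ℕ.< p → x j ℕ.< N → j ≡ q
    x<N⇒j≡q j j<p xj<N = sym (residue-unique q<p j<p (∣ᶻ-*-cancelʳ p N (+ q - + j) pN∣[q-j]N))
      where
      pN∣ : p ℕ.* N ∣ᶻ + ρ + (+ q - + j) * + N - + x j
      pN∣ = subst (λ z → p ℕ.* N ∣ᶻ z - + x j) (r-jN j) (∣ᶻ-modN (+ r - + (j ℕ.* N)) (p ℕ.* N))
      swap : ∀ a b c → b - (a + b - c) ≡ c - a
      swap = solve-∀
      x≡ρ : x j ≡ ρ
      x≡ρ = residue-unique xj<N ρ<N (subst (_ ∣ᶻ_) (swap (+ ρ) ((+ q - + j) * + N) (+ x j))
        (S.∣m∣n⇒∣m-n (S.∣n⇒∣m*n (+ q - + j) (∣ᶻ-self N)) (∣ᶻ-weaken (ℕD.n∣m*n p) pN∣)))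
      cancel : ∀ a b → a + b - a ≡ b
      cancel = solve-∀
      pN∣[q-j]N : p ℕ.* N ∣ᶻ (+ q - + j) * + N
      pN∣[q-j]N = subst (_ ∣ᶻ_) (trans (cong (λ z → + ρ + (+ q - + j) * + N - + z) x≡ρ) (cancel (+ ρ) ((+ q - + j) * + N))) pN∣
    only-q : ∀ j → j ℕ.< p → 𝟙 (x j ℕ.<? N) * g (x j) ≡ 𝟙 (j ℕ.≟ q) * g ρ
    only-q j j<p with j ℕ.≟ q
    ... | yes refl = trans (cong (λ y → 𝟙 (y ℕ.<? N) * g y) x-q)
      (cong (_* g ρ) (trans (𝟙-yes (ρ ℕ.<? N) ρ<N) (sym (𝟙-yes (j ℕ.≟ j) refl))))
    ... | no j≢q = trans (cong (_* g (x j)) (𝟙-no (x j ℕ.<? N) (j≢q ∘ x<N⇒j≡q j j<p)))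
      (sym (cong (_* g ρ) (𝟙-no (j ℕ.≟ q) j≢q)))

  -- The coefficient difference is a multiple of Φ_{p^(k+1)}(x) = Σ_{j<p} x^{j p^k} as soon as it is
  -- p^k-periodic: take the multiplier to be the difference itself, truncated to [0, p^k).
  CycEq-periodic : ∀ p k S T →
    (∀ r → r ℕ.< p ℕ.^ suc k →
      coeff (p ℕ.^ suc k) S r - coeff (p ℕ.^ suc k) T r
        ≡ coeff (p ℕ.^ suc k) S (modN (+ r) (p ℕ.^ k)) - coeff (p ℕ.^ suc k) T (modN (+ r) (p ℕ.^ k))) →
    CycEq p (suc k) S T
  CycEq-periodic p k S T periodic = (λ x → 𝟙 (x ℕ.<? N) * Δ x) , λ r r<n → sym (begin
    sumℤ (map (λ j → 𝟙 (y r j ℕ.<? N) * Δ (y r j)) (upTo p))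
      ≡⟨ sumℤ-map-upTo p _ ⟩
    ∑< p (λ j → 𝟙 (y r j ℕ.<? N) * Δ (y r j))
      ≡⟨ ∑<-window p N Δ ⦃ ℕP.m*n≢0⇒n≢0 p ⦃ ℕ.>-nonZero (ℕP.m<n⇒0<n r<n) ⦄ ⦄ r r<n ⟩
    Δ (modN (+ r) N)
      ≡⟨ sym (periodic r r<n) ⟩
    Δ r ∎)
    where
    N = p ℕ.^ k
    Δ : ℕ → ℤ
    Δ r = coeff (p ℕ.* N) S r - coeff (p ℕ.* N) T r
    y : ℕ → ℕ → ℕ
    y r j = modN (+ r - + (j ℕ.* N)) (p ℕ.* N)

  coeff-const-0 : ∀ n c → .{{ℕ.NonZero n}} → coeff n (const c) 0 ≡ c
  coeff-const-0 n c = trans (coeff-const n c 0 (ℕ.>-nonZero⁻¹ n))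
    (trans (cong (_* c) (𝟙-yes (n ∣ᶻ? 0ℤ - + 0) (∣ᶻ-0 n))) (*-identityˡ c))

  coeff-const-≢0 : ∀ n c {r} → r ≢ 0 → r ℕ.< n → coeff n (const c) r ≡ 0ℤ
  coeff-const-≢0 n c {r} r≢0 r<n = trans (coeff-const n c r r<n)
    (cong (_* c) (𝟙-no (n ∣ᶻ? 0ℤ - + r) (r≢0 ∘ sym ∘ residue-unique (ℕP.m<n⇒0<n r<n) r<n)))

module SquareDivisibility where

  open import Data.Nat
  open import Data.Nat.Properties using (+-suc; *-comm; *-identityʳ; ^-distribˡ-+-*)
  open import Data.Nat.Divisibility
  open import Data.Nat.Primality using (Prime; euclidsLemma; prime⇒nonZero)
  open import Data.Nat.Tactic.RingSolver using (solve-∀)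
  open import Data.Sum using ([_,_])
  open import Function using (id)
  open import Relation.Binary.PropositionalEquality

  p^c∣j⇒p^[2c]∣j² : ∀ p c j → p ^ c ∣ j → p ^ (c + c) ∣ j * j
  p^c∣j⇒p^[2c]∣j² p c j pᶜ∣j = subst (_∣ j * j) (sym (^-distribˡ-+-* p c c)) (*-pres-∣ pᶜ∣j pᶜ∣j)

  module _ {p} (pr : Prime p) where

    private instance
      p≢0 : NonZero p
      p≢0 = prime⇒nonZero pr

    p∣j²⇒p∣j : ∀ j → p ∣ j * j → p ∣ j
    p∣j²⇒p∣j j p∣j² = [ id , id ] (euclidsLemma j j pr p∣j²)

    p^[1+2c]∣j²⇒p^[1+c]∣j : ∀ c j → p ^ suc (c + c) ∣ j * j → p ^ suc c ∣ j
    p^[1+2c]∣j²⇒p^[1+c]∣j zero j p∣j² =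
      subst (_∣ j) (sym (*-identityʳ p)) (p∣j²⇒p∣j j (subst (_∣ j * j) (*-identityʳ p) p∣j²))
    p^[1+2c]∣j²⇒p^[1+c]∣j (suc c) j p^[3+2c]∣j²
      with p∣j²⇒p∣j j (∣-trans (divides (p ^ (suc c + suc c)) (*-comm p _)) p^[3+2c]∣j²)
    ... | divides j′ refl = subst (_∣ j′ * p) (*-comm (p ^ suc c) p) (*-monoˡ-∣ p (p^[1+2c]∣j²⇒p^[1+c]∣j c j′ p^[1+2c]∣j′²))
      where
      factor : ∀ j′ p → j′ * p * (j′ * p) ≡ p * (p * (j′ * j′))
      factor = solve-∀
      p^[1+2c]∣j′² : p ^ suc (c + c) ∣ j′ * j′
      p^[1+2c]∣j′² = *-cancelˡ-∣ p (*-cancelˡ-∣ p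
        (subst₂ _∣_ (cong (λ e → p ^ suc (suc e)) (+-suc c c)) (factor j′ p) p^[3+2c]∣j²))

    p^[2c]∣j²⇒p^c∣j : ∀ c j → p ^ (c + c) ∣ j * j → p ^ c ∣ j
    p^[2c]∣j²⇒p^c∣j zero j _ = 1∣ j
    p^[2c]∣j²⇒p^c∣j (suc c) j p^[2+2c]∣j² =
      p^[1+2c]∣j²⇒p^[1+c]∣j c j (∣-trans (divides p (cong (λ e → p * p ^ e) (+-suc c c))) p^[2+2c]∣j²)

module QuadraticCongruence where

  open import Data.Bool using (if_then_else_)
  open import Data.Nat as ℕ using (ℕ)
  import Data.Nat.Properties as ℕP
  import Data.Nat.Divisibility as ℕD
  open import Data.Nat.Primality using (Prime; prime⇒nonZero)
  open import Data.Integer using (ℤ; +_; _+_; _-_; _*_; -_; ∣_∣; 0ℤ; 1ℤ)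
  open import Data.Integer.Properties
  import Data.Integer.Divisibility.Signed as S
  open import Data.Integer.Tactic.RingSolver using (solve-∀)
  open import Data.List using (upTo)
  open import Data.List.Relation.Unary.Any using (Any; any?)
  open import Data.List.Membership.Propositional using (find; lose)
  open import Data.List.Membership.Propositional.Properties using (∈-upTo⁺)
  open import Data.Product using (_,_; proj₁; proj₂)
  open import Data.Sum using (_⊎_; inj₁; inj₂)
  open import Data.Empty using (⊥-elim)
  open import Relation.Nullary using (¬_; Dec; yes; no; does)
  open import Relation.Nullary.Decidable using (dec-false)
  open import Relation.Binary.PropositionalEquality
  open ≡-Reasoning
  open FiniteSums
  open IntegerDivisibility
  open PrimePowerResidues

  𝟙-∣-quadratic-periodic : ∀ p a m i →
    𝟙 (p ∣ᶻ? a * (+ (p ℕ.+ i) * + (p ℕ.+ i)) - m) ≡ 𝟙 (p ∣ᶻ? a * (+ i * + i) - m)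
  𝟙-∣-quadratic-periodic p a m i = 𝟙-⇔ (p ∣ᶻ? x) (p ∣ᶻ? y)
    (λ p∣x → subst (_ ∣ᶻ_) (cancel₁ x y) (S.∣m∣n⇒∣m-n p∣x p∣x-y))
    (λ p∣y → subst (_ ∣ᶻ_) (cancel₂ y x) (S.∣m∣n⇒∣m+n p∣y p∣x-y))
    where
    x = a * (+ (p ℕ.+ i) * + (p ℕ.+ i)) - m
    y = a * (+ i * + i) - m
    expand : ∀ a p i m → a * ((p + i) * (p + i)) - m - (a * (i * i) - m) ≡ a * (p + i + i) * p
    expand = solve-∀
    p∣x-y : p ∣ᶻ x - y
    p∣x-y = subst (_ ∣ᶻ_) (sym (trans (cong (λ z → a * (z * z) - m - y) (pos-+ p i)) (expand a (+ p) (+ i) m)))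
      (S.∣n⇒∣m*n (a * (+ p + + i + + i)) (∣ᶻ-self p))
    cancel₁ : ∀ x y → x - (x - y) ≡ y
    cancel₁ = solve-∀
    cancel₂ : ∀ y x → y + (x - y) ≡ x
    cancel₂ = solve-∀

  module _ {p} (pr : Prime p) (p-odd : ¬ 2 ℕD.∣ p) (a m : ℤ) (p∤a : ¬ p ∣ᶻ a) (p∤m : ¬ p ∣ᶻ m) where

    private instance
      p≢0 : ℕ.NonZero p
      p≢0 = prime⇒nonZero pr

    Root : ℕ → Set
    Root x = p ∣ᶻ a * (+ x * + x) - m

    SquareRoot : ℕ → Set
    SquareRoot y = modN (+ y * + y - a * m) p ≡ 0

    squareRoot? : Dec (Any SquareRoot (upTo p))
    squareRoot? = any? (λ y → modN (+ y * + y - a * m) p ℕ.≟ 0) (upTo p)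

    legendre-unit : legendre (a * m) p ≡ (if does squareRoot? then 1ℤ else - 1ℤ)
    legendre-unit = cong (λ b → if b then 0ℤ else (if does squareRoot? then 1ℤ else - 1ℤ)) (dec-false (p ℕD.∣? ∣ a * m ∣) p∤am)
      where
      p∤am : ¬ p ℕD.∣ ∣ a * m ∣
      p∤am p∣am with ∣ᶻ-euclid pr a m (S.∣ᵤ⇒∣ p∣am)
      ... | inj₁ p∣a = p∤a p∣a
      ... | inj₂ p∣m = p∤m p∣m

    root⇒squareRoot : ∀ x → Root x → SquareRoot (modN (a * + x) p)
    root⇒squareRoot x root = ∣ᶻ⇒modN≡0 _ p (subst (_ ∣ᶻ_) (combine a m (+ x) (+ y))
      (S.∣m∣n⇒∣m+n (S.∣n⇒∣m*n (- (+ y + a * + x)) (∣ᶻ-modN (a * + x) p)) (S.∣n⇒∣m*n a root)))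
      where
      y = modN (a * + x) p
      combine : ∀ a m x y → - (y + a * x) * (a * x - y) + a * (a * (x * x) - m) ≡ y * y - a * m
      combine = solve-∀

    private
      a⁻¹ : ℤ
      a⁻¹ = proj₁ (unit-inverse pr 1 a p∤a)
      p∣aa⁻¹-1 : p ∣ᶻ a * a⁻¹ - 1ℤ
      p∣aa⁻¹-1 = subst (_∣ᶻ a * a⁻¹ - 1ℤ) (ℕP.*-identityʳ p) (proj₂ (unit-inverse pr 1 a p∤a))

    squareRoot⇒root : ∀ y → SquareRoot y → Root (modN (+ y * a⁻¹) p)
    squareRoot⇒root y y²≡am = subst (_ ∣ᶻ_) (combine a m (+ y) a⁻¹ (+ x))
      (S.∣m∣n⇒∣m+n (S.∣m∣n⇒∣m+n (S.∣n⇒∣m*n (- (a * (+ x + + y * a⁻¹))) (∣ᶻ-modN (+ y * a⁻¹) p))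
                                 (S.∣n⇒∣m*n (a⁻¹ * a⁻¹ * a) (modN≡0⇒∣ᶻ _ p y²≡am)))
                   (S.∣n⇒∣m*n (m * (a * a⁻¹ + 1ℤ)) p∣aa⁻¹-1))
      where
      x = modN (+ y * a⁻¹) p
      combine : ∀ a m y i x → - (a * (x + y * i)) * (y * i - x) + i * i * a * (y * y - a * m)
        + m * (a * i + 1ℤ) * (a * i - 1ℤ) ≡ a * (x * x) - m
      combine = solve-∀

    root? : ∀ x → Dec (Root x)
    root? x = p ∣ᶻ? a * (+ x * + x) - m

    two-roots : ∀ x₁ → x₁ ℕ.< p → Root x₁ → ∑< p (λ x → 𝟙 (root? x)) ≡ + 2
    two-roots x₁ x₁<p root₁ = begin
      ∑< p (λ x → 𝟙 (root? x))
        ≡⟨ ∑<-cong p (λ x x<p → 𝟙-⊎ (root? x) (x ℕ.≟ x₁) (x ℕ.≟ x₂)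
             (only-roots x x<p) (λ { refl → root₁ }) (λ { refl → root₂ })
             (λ (x≡x₁ , x≡x₂) → x₁≢x₂ (trans (sym x≡x₁) x≡x₂))) ⟩
      ∑< p (λ x → 𝟙 (x ℕ.≟ x₁) + 𝟙 (x ℕ.≟ x₂))
        ≡⟨ ∑<-+ p _ _ ⟩
      ∑< p (λ x → 𝟙 (x ℕ.≟ x₁)) + ∑< p (λ x → 𝟙 (x ℕ.≟ x₂))
        ≡⟨ cong₂ _+_ (∑<-𝟙-≟ p x₁ x₁<p) (∑<-𝟙-≟ p x₂ x₂<p) ⟩
      + 2 ∎
      where
      x₁≢0 : x₁ ≢ 0
      x₁≢0 refl = p∤m (subst (_ ∣ᶻ_) (vanish a m) (S.∣m⇒∣-m root₁))
        where
        vanish : ∀ a m → - (a * (0ℤ * 0ℤ) - m) ≡ m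
        vanish = solve-∀
      x₂ = p ℕ.∸ x₁
      x₂<p : x₂ ℕ.< p
      x₂<p = ℕP.∸-monoʳ-< (ℕP.n≢0⇒n>0 x₁≢0) (ℕP.<⇒≤ x₁<p)
      x₂≡p-x₁ : + x₂ ≡ + p - + x₁
      x₂≡p-x₁ = trans (sym (⊖-≥ (ℕP.<⇒≤ x₁<p))) (sym (m-n≡m⊖n p x₁))
      x₁≢x₂ : x₁ ≢ x₂
      x₁≢x₂ x₁≡x₂ = p-odd (ℕD.divides x₁ (begin
        p               ≡⟨ sym (ℕP.m∸n+n≡m (ℕP.<⇒≤ x₁<p)) ⟩
        x₂ ℕ.+ x₁       ≡⟨ cong (ℕ._+ x₁) (sym x₁≡x₂) ⟩
        x₁ ℕ.+ x₁       ≡⟨ cong (x₁ ℕ.+_) (sym (ℕP.+-identityʳ x₁)) ⟩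
        2 ℕ.* x₁        ≡⟨ ℕP.*-comm 2 x₁ ⟩
        x₁ ℕ.* 2        ∎))
      root₂ : Root x₂
      root₂ = subst (λ z → p ∣ᶻ a * (z * z) - m) (sym x₂≡p-x₁)
        (subst (_ ∣ᶻ_) (reflect a m (+ x₁) (+ p)) (S.∣m∣n⇒∣m+n root₁ (S.∣n⇒∣m*n (a * (+ p - + x₁ - + x₁)) (∣ᶻ-self p))))
        where
        reflect : ∀ a m x p → a * (x * x) - m + a * (p - x - x) * p ≡ a * ((p - x) * (p - x)) - m
        reflect = solve-∀
      only-roots : ∀ x → x ℕ.< p → Root x → x ≡ x₁ ⊎ x ≡ x₂
      only-roots x x<p root with ∣ᶻ-euclid pr a _ (subst (_ ∣ᶻ_) (factor a m (+ x) (+ x₁)) (S.∣m∣n⇒∣m-n root root₁))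
        where
        factor : ∀ a m x y → (a * (x * x) - m) - (a * (y * y) - m) ≡ a * ((x - y) * (x + y))
        factor = solve-∀
      ... | inj₁ p∣a = ⊥-elim (p∤a p∣a)
      ... | inj₂ p∣[x-x₁][x+x₁] with ∣ᶻ-euclid pr (+ x - + x₁) (+ x + + x₁) p∣[x-x₁][x+x₁]
      ...   | inj₁ p∣x-x₁ = inj₁ (residue-unique x<p x₁<p p∣x-x₁)
      ...   | inj₂ p∣x+x₁ = inj₂ (residue-unique x<p x₂<p
              (subst (_ ∣ᶻ_) (trans (shift (+ x) (+ x₁) (+ p)) (cong (_-_ (+ x)) (sym x₂≡p-x₁)))
                (S.∣m∣n⇒∣m-n p∣x+x₁ (∣ᶻ-self p))))
        where
        shift : ∀ x y p → x + y - p ≡ x - (p - y)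
        shift = solve-∀

    count-roots : ∑< p (λ x → 𝟙 (root? x)) ≡ 1ℤ + legendre (a * m) p
    count-roots rewrite legendre-unit with squareRoot?
    ... | yes has-root with (y , _ , y²≡am) ← find has-root = two-roots _ (modN-< (+ y * a⁻¹) p) (squareRoot⇒root y y²≡am)
    ... | no no-root = ∑<-≡0 p _ (λ x _ → 𝟙-no (root? x)
      (λ root → no-root (lose (∈-upTo⁺ (modN-< (a * + x) p)) (root⇒squareRoot x root))))

module Sₖτ where

  open import Data.Nat as ℕ using (ℕ; zero; suc)
  import Data.Nat.Properties as ℕP
  import Data.Nat.Divisibility as ℕD
  import Data.Nat.Coprimality as ℕC
  open import Data.Nat.Primality using (Prime; prime⇒nonZero; prime⇒nonTrivial)
  open import Data.Integer using (ℤ; +_; _+_; _-_; _*_; -_; 0ℤ; 1ℤ; ≢-nonZero)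
  open import Data.Integer.Properties
  import Data.Integer.Divisibility.Signed as S
  open import Data.Integer.Tactic.RingSolver using (solve-∀)
  open import Data.Nat.Tactic.RingSolver renaming (solve-∀ to solveℕ-∀)
  open import Data.List using ([]; _∷_; map; upTo; filter)
  open import Data.Product using (_,_)
  open import Relation.Nullary using (¬_; yes; no)
  open import Relation.Binary.PropositionalEquality
  open ≡-Reasoning
  open import Function using (_∘_)
  open FiniteSums
  open IntegerDivisibility
  open ExponentialSums
  open PrimePowerResidues
  open SquareDivisibility
  open QuadraticCongruence using (count-roots; 𝟙-∣-quadratic-periodic)

  module _ {p} (pr : Prime p) (a m₀ : ℤ) (m₁ τ : ℕ) where

    private instance
      p≢0 : ℕ.NonZero p
      p≢0 = prime⇒nonZero pr

    k n Q N : ℕ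
    k = suc (m₁ ℕ.+ τ)
    n = p ℕ.^ k
    Q = p ℕ.^ suc m₁
    N = p ℕ.^ (m₁ ℕ.+ τ)

    E : ℕ → ℕ → ℤ
    E t j = - (m₀ * + t * + (p ℕ.^ (m₁ ℕ.+ τ))) + a * + t * + (p ℕ.^ τ) * (+ j * + j)

    hits : ℕ → ℕ → ℤ
    hits t r = ∑< n (λ j → 𝟙 (n ∣ᶻ? E t j - + r))

    multiplicity : ℕ → ℤ
    multiplicity r = ∑< Q (λ t → 𝟙 (ℕC.coprime? t Q) * hits t r)

    coeff-sₖτ : ∀ b₀ b₁ c₀ c₁ → k ℕ.≤ b₁ ℕ.+ τ → k ℕ.≤ c₁ ℕ.+ τ → ∀ r → r ℕ.< n →
      coeff n (sₖτ p a b₀ b₁ c₀ c₁ m₀ m₁ k τ) r ≡ + n * (+ n * multiplicity r)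
    coeff-sₖτ b₀ b₁ c₀ c₁ k≤b₁+τ k≤c₁+τ r r<n = begin
      coeff n (sₖτ p a b₀ b₁ c₀ c₁ m₀ m₁ k τ) r
        ≡⟨ coeff-concatMap n term (filter (λ t → ℕC.coprime? t Q′) (upTo Q′)) r ⟩
      sumℤ (map (λ t → coeff n (term t) r) (filter (λ t → ℕC.coprime? t Q′) (upTo Q′)))
        ≡⟨ sumℤ-filter (λ t → ℕC.coprime? t Q′) _ (upTo Q′) ⟩
      sumℤ (map (λ t → 𝟙 (ℕC.coprime? t Q′) * coeff n (term t) r) (upTo Q′))
        ≡⟨ cong (λ e → sumℤ (map (λ t → 𝟙 (ℕC.coprime? t (p ℕ.^ e)) * coeff n (term t) r) (upTo (p ℕ.^ e))))
            (ℕP.m+n∸n≡m (suc m₁) τ) ⟩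
      sumℤ (map (λ t → 𝟙 (ℕC.coprime? t Q) * coeff n (term t) r) (upTo Q))
        ≡⟨ sumℤ-map-upTo Q _ ⟩
      ∑< Q (λ t → 𝟙 (ℕC.coprime? t Q) * coeff n (term t) r)
        ≡⟨ ∑<-cong Q (λ t _ → trans (cong (𝟙 (ℕC.coprime? t Q) *_) (coeff-term t))
            (shuffle (𝟙 (ℕC.coprime? t Q)) (+ n) (hits t r))) ⟩
      ∑< Q (λ t → + n * (+ n * (𝟙 (ℕC.coprime? t Q) * hits t r)))
        ≡⟨ trans (∑<-*ˡ Q (+ n) _) (cong (+ n *_) (∑<-*ˡ Q (+ n) _)) ⟩
      + n * (+ n * multiplicity r) ∎
      where
      Q′ = p ℕ.^ (k ℕ.∸ τ)
      shuffle : ∀ u n h → u * (n * (n * h)) ≡ n * (n * (u * h))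
      shuffle = solve-∀
      n∣pᵉ : ∀ {e} → k ℕ.≤ e → n ∣ᶻ + (p ℕ.^ e)
      n∣pᵉ k≤e = S.∣ᵤ⇒∣ (^-∣-^ p k≤e)
      with-a with-ab term : ℕ → ExpSum
      with-a t = ((+ 1 , - (m₀ * + t * + (p ℕ.^ (m₁ ℕ.+ τ)))) ∷ []) ⊗ gauss (a * + t * + (p ℕ.^ τ)) n
      with-ab t = with-a t ⊗ gauss (b₀ * + t * + (p ℕ.^ (b₁ ℕ.+ τ))) n
      term t = with-ab t ⊗ gauss (c₀ * + t * + (p ℕ.^ (c₁ ℕ.+ τ))) n
      coeff-term : ∀ t → coeff n (term t) r ≡ + n * (+ n * hits t r)
      coeff-term t = begin
        coeff n (term t) r
          ≡⟨ coeff-⊗-trivial-gauss n (with-ab t) _ n r (S.∣n⇒∣m*n (c₀ * + t) (n∣pᵉ k≤c₁+τ)) ⟩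
        + n * coeff n (with-ab t) r
          ≡⟨ cong (+ n *_) (coeff-⊗-trivial-gauss n (with-a t) _ n r (S.∣n⇒∣m*n (b₀ * + t) (n∣pᵉ k≤b₁+τ))) ⟩
        + n * (+ n * coeff n (with-a t) r)
          ≡⟨ cong (λ x → + n * (+ n * x))
              (trans (coeff-monomial-⊗-gauss n (+ 1) (- (m₀ * + t * + (p ℕ.^ (m₁ ℕ.+ τ)))) (a * + t * + (p ℕ.^ τ)) n r r<n)
              (∑<-cong n (λ j _ → *-identityʳ (𝟙 (n ∣ᶻ? E t j - + r))))) ⟩
        + n * (+ n * hits t r) ∎

    Z : ℕ → ℤ
    Z j = a * (+ j * + j) - m₀ * + (p ℕ.^ m₁)

    E≡t*p^τ*Z : ∀ t j → E t j ≡ + t * (+ (p ℕ.^ τ) * Z j)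
    E≡t*p^τ*Z t j = trans (cong (λ x → - (m₀ * + t * x) + a * + t * + (p ℕ.^ τ) * (+ j * + j)) pᵐ¹⁺ᵗ≡)
                       (factor m₀ (+ t) (+ (p ℕ.^ m₁)) (+ (p ℕ.^ τ)) a (+ j * + j))
      where
      pᵐ¹⁺ᵗ≡ : + (p ℕ.^ (m₁ ℕ.+ τ)) ≡ + (p ℕ.^ m₁) * + (p ℕ.^ τ)
      pᵐ¹⁺ᵗ≡ = trans (cong +_ (ℕP.^-distribˡ-+-* p m₁ τ)) (pos-* (p ℕ.^ m₁) (p ℕ.^ τ))
      factor : ∀ m t P T a J → - (m * t * (P * T)) + a * t * T * J ≡ t * (T * (a * J - m * P))
      factor = solve-∀

    multiplicity-unit : ∀ {r r′ w} → ¬ p ∣ᶻ w → n ∣ᶻ + r′ - w * + r → multiplicity r′ ≡ multiplicity r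
    multiplicity-unit {r} {r′} {w} p∤w n∣r′-wr = begin
      ∑< Q (λ t → 𝟙 (ℕC.coprime? t Q) * hits t r′)
        ≡⟨ sym (∑<-reindex-by-unit pr (suc m₁) w p∤w (λ t → 𝟙 (ℕC.coprime? t Q) * hits t r′)) ⟩
      ∑< Q (λ t → 𝟙 (ℕC.coprime? (φ t) Q) * hits (φ t) r′)
        ≡⟨ ∑<-cong Q (λ t _ → cong₂ _*_ (𝟙-coprime-unit-multiple pr m₁ w t p∤w) (same-hits t)) ⟩
      ∑< Q (λ t → 𝟙 (ℕC.coprime? t Q) * hits t r) ∎
      where
      instance _ = ℕP.m^n≢0 p (suc m₁)
      φ : ℕ → ℕ
      φ t = modN (+ t * w) Q
      n∣Eφt-wEt : ∀ t j → n ∣ᶻ E (φ t) j - w * E t j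
      n∣Eφt-wEt t j = subst₂ _∣ᶻ_ (sym (ℕP.^-distribˡ-+-* p (suc m₁) τ))
        (sym (trans (cong₂ (λ x y → x - w * y) (E≡t*p^τ*Z (φ t) j) (E≡t*p^τ*Z t j)) (factor (+ φ t) w (+ t) (+ (p ℕ.^ τ) * Z j))))
        (∣ᶻ-*-mono (subst (_ ∣ᶻ_) (negate (+ t * w) (+ φ t)) (S.∣m⇒∣-m (∣ᶻ-modN (+ t * w) Q)))
          (S.∣m⇒∣m*n (Z j) (∣ᶻ-self (p ℕ.^ τ))))
        where
        factor : ∀ f w t x → f * x - w * (t * x) ≡ (f - t * w) * x
        factor = solve-∀
        negate : ∀ x y → - (x - y) ≡ y - x
        negate = solve-∀
      same-hits : ∀ t → hits (φ t) r′ ≡ hits t r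
      same-hits t = ∑<-cong n (λ j _ → 𝟙-⇔ (n ∣ᶻ? E (φ t) j - + r′) (n ∣ᶻ? E t j - + r)
        (∣ᶻ-unit-scale⁻ pr k {w} {E t j} {E (φ t) j} {+ r} {+ r′} p∤w (n∣Eφt-wEt t j) n∣r′-wr)
        (∣ᶻ-unit-scale⁺ pr k {w} {E t j} {E (φ t) j} {+ r} {+ r′} p∤w (n∣Eφt-wEt t j) n∣r′-wr))

    multiplicity-coset : ∀ r → ¬ N ∣ᶻ + r → multiplicity r ≡ multiplicity (modN (+ r) N)
    multiplicity-coset r N∤r with unit-multiple pr (m₁ ℕ.+ τ) k N∤ρ (∣ᶻ-modN (+ r) N)
      where
      instance _ = ℕP.m^n≢0 p (m₁ ℕ.+ τ)
      cancel : ∀ x y → x - y + y ≡ x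
      cancel = solve-∀
      N∤ρ : ¬ N ∣ᶻ + modN (+ r) N
      N∤ρ N∣ρ = N∤r (subst (_ ∣ᶻ_) (cancel (+ r) (+ modN (+ r) N)) (S.∣m∣n⇒∣m+n (∣ᶻ-modN (+ r) N) N∣ρ))
    ... | w , p∤w , n∣r-wρ = multiplicity-unit p∤w n∣r-wρ

    multiplicity-multiple : ∀ i → ¬ p ℕD.∣ i → multiplicity (i ℕ.* N) ≡ multiplicity N
    multiplicity-multiple i p∤i = multiplicity-unit {w = + i} (p∤i ∘ S.∣⇒∣ᵤ)
      (subst (_ ∣ᶻ_) (sym (trans (cong (_- + i * + N) (pos-* i N)) (+-inverseʳ (+ i * + N)))) (∣ᶻ-0 n))

    count-Q∣Z count-p^m₁∣Z : ℤ
    count-Q∣Z = ∑< n (λ j → 𝟙 (Q ∣ᶻ? Z j))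
    count-p^m₁∣Z = ∑< n (λ j → 𝟙 (p ℕ.^ m₁ ∣ᶻ? Z j))

    𝟙-p^[e+τ]∣E : ∀ e t j → ¬ p ℕD.∣ t → 𝟙 (p ℕ.^ (e ℕ.+ τ) ∣ᶻ? E t j) ≡ 𝟙 (p ℕ.^ e ∣ᶻ? Z j)
    𝟙-p^[e+τ]∣E e t j p∤t = 𝟙-⇔ (p ℕ.^ (e ℕ.+ τ) ∣ᶻ? E t j) (p ℕ.^ e ∣ᶻ? Z j)
      (p^[e+τ]∣t*p^τ*z⇒p^e∣z pr e τ t (Z j) p∤t ∘ subst (_ ∣ᶻ_) (E≡t*p^τ*Z t j))
      (subst (_ ∣ᶻ_) (sym (E≡t*p^τ*Z t j)) ∘ p^e∣z⇒p^[e+τ]∣t*p^τ*z pr e τ t (Z j) p∤t)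

    multiplicity-0 : multiplicity 0 ≡ + (p ℕ.^ m₁) * (+ p - 1ℤ) * count-Q∣Z
    multiplicity-0 = ∑<-units pr m₁ (λ t → hits t 0) count-Q∣Z λ t p∤t →
      ∑<-cong n λ j _ → trans (cong (λ x → 𝟙 (n ∣ᶻ? x)) (+-identityʳ (E t j))) (𝟙-p^[e+τ]∣E (suc m₁) t j p∤t)

    ∑<-multiplicity-iN : ∑< p (λ i → multiplicity (i ℕ.* N)) ≡ + (p ℕ.^ m₁) * (+ p - 1ℤ) * count-p^m₁∣Z
    ∑<-multiplicity-iN = begin
      ∑< p (λ i → ∑< Q (λ t → 𝟙 (ℕC.coprime? t Q) * hits t (i ℕ.* N)))
        ≡⟨ ∑<-comm p Q _ ⟩
      ∑< Q (λ t → ∑< p (λ i → 𝟙 (ℕC.coprime? t Q) * hits t (i ℕ.* N)))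
        ≡⟨ ∑<-cong Q (λ t _ → ∑<-*ˡ p (𝟙 (ℕC.coprime? t Q)) (λ i → hits t (i ℕ.* N))) ⟩
      ∑< Q (λ t → 𝟙 (ℕC.coprime? t Q) * ∑< p (λ i → hits t (i ℕ.* N)))
        ≡⟨ ∑<-units pr m₁ _ count-p^m₁∣Z hits-N-multiples ⟩
      + (p ℕ.^ m₁) * (+ p - 1ℤ) * count-p^m₁∣Z ∎
      where
      instance _ = ℕP.m^n≢0 p (m₁ ℕ.+ τ)
      hits-N-multiples : ∀ t → ¬ p ℕD.∣ t → ∑< p (λ i → hits t (i ℕ.* N)) ≡ count-p^m₁∣Z
      hits-N-multiples t p∤t = begin
        ∑< p (λ i → ∑< n (λ j → 𝟙 (n ∣ᶻ? E t j - + (i ℕ.* N))))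
          ≡⟨ ∑<-comm p n _ ⟩
        ∑< n (λ j → ∑< p (λ i → 𝟙 (n ∣ᶻ? E t j - + (i ℕ.* N))))
          ≡⟨ ∑<-cong n (λ j _ → ∑<-𝟙-∣-shifts p N (E t j)) ⟩
        ∑< n (λ j → 𝟙 (N ∣ᶻ? E t j))
          ≡⟨ ∑<-cong n (λ j _ → 𝟙-p^[e+τ]∣E m₁ t j p∤t) ⟩
        count-p^m₁∣Z ∎

    ∑<-multiplicity-iN-by-invariance : ∑< p (λ i → multiplicity (i ℕ.* N)) ≡ multiplicity 0 + (+ p - 1ℤ) * multiplicity N
    ∑<-multiplicity-iN-by-invariance = begin
      ∑< p (λ i → multiplicity (i ℕ.* N))
        ≡⟨ cong (λ x → ∑< x (λ i → multiplicity (i ℕ.* N))) (sym (ℕP.suc-pred p)) ⟩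
      ∑< (suc p′) (λ i → multiplicity (i ℕ.* N))
        ≡⟨ ∑<-sucˡ p′ _ ⟩
      multiplicity 0 + ∑< p′ (λ i → multiplicity (suc i ℕ.* N))
        ≡⟨ cong (_+_ (multiplicity 0)) (∑<-cong p′ (λ i i<p′ → multiplicity-multiple (suc i) (p∤1+i i<p′))) ⟩
      multiplicity 0 + ∑< p′ (λ _ → multiplicity N)
        ≡⟨ cong (_+_ (multiplicity 0)) (trans (∑<-const p′ _) (cong (_* multiplicity N) p′≡p-1)) ⟩
      multiplicity 0 + (+ p - 1ℤ) * multiplicity N ∎
      where
      p′ = ℕ.pred p
      p∤1+i : ∀ {i} → i ℕ.< p′ → ¬ p ℕD.∣ suc i
      p∤1+i i<p′ p∣1+i = ℕP.<⇒≱ (subst (suc _ ℕ.<_) (ℕP.suc-pred p) (ℕ.s≤s i<p′)) (ℕD.∣⇒≤ p∣1+i)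
      p′≡p-1 : + p′ ≡ + p - 1ℤ
      p′≡p-1 = sym (trans (cong (λ x → + x - 1ℤ) (sym (ℕP.suc-pred p))) (trans (cong (_- 1ℤ) (pos-+ 1 p′)) (cancel (+ p′))))
        where
        cancel : ∀ x → 1ℤ + x - 1ℤ ≡ x
        cancel = solve-∀

    -- Compare the two evaluations of Σ_{i<p} multiplicity (i N) and cancel p - 1.
    multiplicity-gap : multiplicity 0 - multiplicity N ≡ + (p ℕ.^ m₁) * (+ p * count-Q∣Z - count-p^m₁∣Z)
    multiplicity-gap = *-cancelˡ-≡ (+ p - 1ℤ) _ _ ⦃ ≢-nonZero p-1≢0 ⦄ (begin
      (+ p - 1ℤ) * (C₀ - C₁)
        ≡⟨ rearrange (+ p) C₀ C₁ ⟩
      + p * C₀ - (C₀ + (+ p - 1ℤ) * C₁)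
        ≡⟨ cong₂ (λ x y → + p * x - y) multiplicity-0 (trans (sym ∑<-multiplicity-iN-by-invariance) ∑<-multiplicity-iN) ⟩
      + p * (P * (+ p - 1ℤ) * count-Q∣Z) - P * (+ p - 1ℤ) * count-p^m₁∣Z
        ≡⟨ collect (+ p) P count-Q∣Z count-p^m₁∣Z ⟩
      (+ p - 1ℤ) * (P * (+ p * count-Q∣Z - count-p^m₁∣Z)) ∎)
      where
      C₀ = multiplicity 0
      C₁ = multiplicity N
      P = + (p ℕ.^ m₁)
      rearrange : ∀ p x y → (p - 1ℤ) * (x - y) ≡ p * x - (x + (p - 1ℤ) * y)
      rearrange = solve-∀
      collect : ∀ p P a b → p * (P * (p - 1ℤ) * a) - P * (p - 1ℤ) * b ≡ (p - 1ℤ) * (P * (p * a - b))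
      collect = solve-∀
      p-1≢0 : + p - 1ℤ ≢ 0ℤ
      p-1≢0 p-1≡0 = ℕ.nonTrivial⇒≢1 ⦃ prime⇒nonTrivial pr ⦄ (+-injective (i-j≡0⇒i≡j (+ p) 1ℤ p-1≡0))

    sₖτ≈const : ∀ b₀ b₁ c₀ c₁ → k ℕ.≤ b₁ ℕ.+ τ → k ℕ.≤ c₁ ℕ.+ τ → ∀ T →
      + n * (+ n * (multiplicity 0 - multiplicity N)) ≡ T → CycEq p k (sₖτ p a b₀ b₁ c₀ c₁ m₀ m₁ k τ) (const T)
    sₖτ≈const b₀ b₁ c₀ c₁ k≤b₁+τ k≤c₁+τ T n²-gap≡T = CycEq-periodic p (m₁ ℕ.+ τ) S (const T) periodic
      where
      instance
        n≢0 : ℕ.NonZero n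
        n≢0 = ℕP.m^n≢0 p k
        N≢0 : ℕ.NonZero N
        N≢0 = ℕP.m^n≢0 p (m₁ ℕ.+ τ)
      S = sₖτ p a b₀ b₁ c₀ c₁ m₀ m₁ k τ
      Δ : ℕ → ℤ
      Δ r = coeff n S r - coeff n (const T) r
      n²C : ℕ → ℤ
      n²C r = + n * (+ n * multiplicity r)
      N<n : N ℕ.< n
      N<n = subst (N ℕ.<_) (ℕP.*-comm N p) (ℕP.m<m*n N p (ℕ.nonTrivial⇒n>1 p ⦃ prime⇒nonTrivial pr ⦄))
      Δ-≢0 : ∀ {r} → r ≢ 0 → r ℕ.< n → Δ r ≡ n²C r
      Δ-≢0 {r} r≢0 r<n = trans (cong₂ _-_ (coeff-sₖτ b₀ b₁ c₀ c₁ k≤b₁+τ k≤c₁+τ r r<n)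
          (coeff-const-≢0 n T r≢0 r<n)) (+-identityʳ _)
      Δ-0 : Δ 0 ≡ n²C N
      Δ-0 = begin
        coeff n S 0 - coeff n (const T) 0
          ≡⟨ cong₂ _-_ (coeff-sₖτ b₀ b₁ c₀ c₁ k≤b₁+τ k≤c₁+τ 0 (ℕ.>-nonZero⁻¹ n)) (coeff-const-0 n T) ⟩
        n²C 0 - T
          ≡⟨ cong (_-_ (n²C 0)) (sym n²-gap≡T) ⟩
        n²C 0 - + n * (+ n * (multiplicity 0 - multiplicity N))
          ≡⟨ cancel (+ n) (multiplicity 0) (multiplicity N) ⟩
        n²C N ∎
        where
        cancel : ∀ n x y → n * (n * x) - n * (n * (x - y)) ≡ n * (n * y)
        cancel = solve-∀
      periodic : ∀ r → r ℕ.< n → Δ r ≡ Δ (modN (+ r) N)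
      periodic r r<n with N ∣ᶻ? + r
      ... | no N∤r = begin
        Δ r      ≡⟨ Δ-≢0 (λ { refl → N∤r (∣ᶻ-0 N) }) r<n ⟩
        n²C r    ≡⟨ cong (λ x → + n * (+ n * x)) (multiplicity-coset r N∤r) ⟩
        n²C ρ    ≡⟨ sym (Δ-≢0 ρ≢0 (ℕP.<-trans (modN-< (+ r) N) N<n)) ⟩
        Δ ρ      ∎
        where
        ρ = modN (+ r) N
        ρ≢0 : ρ ≢ 0
        ρ≢0 = N∤r ∘ modN≡0⇒∣ᶻ (+ r) N
      ... | yes N∣r = trans (Δ-N-multiple (S.∣⇒∣ᵤ N∣r)) (sym (trans (cong Δ (∣ᶻ⇒modN≡0 (+ r) N N∣r)) Δ-0))
        where
        Δ-N-multiple : N ℕD.∣ r → Δ r ≡ n²C N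
        Δ-N-multiple (ℕD.divides zero refl) = Δ-0
        Δ-N-multiple (ℕD.divides i@(suc _) refl) = begin
          Δ (i ℕ.* N)      ≡⟨ Δ-≢0 (ℕ.≢-nonZero⁻¹ (i ℕ.* N) ⦃ ℕP.m*n≢0 i N ⦄) r<n ⟩
          n²C (i ℕ.* N)    ≡⟨ cong (λ x → + n * (+ n * x)) (multiplicity-multiple i p∤i) ⟩
          n²C N            ∎
          where
          p∤i : ¬ p ℕD.∣ i
          p∤i p∣i = ℕP.<⇒≱ (ℕP.*-cancelʳ-< N i p r<n) (ℕD.∣⇒≤ p∣i)

    n≡p^[1+l+τ]*p^l : ∀ l → m₁ ≡ l ℕ.+ l → n ≡ p ℕ.^ suc (l ℕ.+ τ) ℕ.* p ℕ.^ l
    n≡p^[1+l+τ]*p^l l refl = trans (cong (p ℕ.^_) (regroup l τ)) (ℕP.^-distribˡ-+-* p (suc (l ℕ.+ τ)) l)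
      where
      regroup : ∀ l τ → suc ((l ℕ.+ l) ℕ.+ τ) ≡ suc (l ℕ.+ τ) ℕ.+ l
      regroup = solveℕ-∀

    n≡p^[1+l+τ]*p^[1+l] : ∀ l → m₁ ≡ suc (l ℕ.+ l) → n ≡ p ℕ.^ suc (l ℕ.+ τ) ℕ.* p ℕ.^ suc l
    n≡p^[1+l+τ]*p^[1+l] l refl = trans (cong (p ℕ.^_) (regroup l τ)) (ℕP.^-distribˡ-+-* p (suc (l ℕ.+ τ)) (suc l))
      where
      regroup : ∀ l τ → suc (suc (l ℕ.+ l) ℕ.+ τ) ≡ suc (l ℕ.+ τ) ℕ.+ suc l
      regroup = solveℕ-∀

    module _ (p∤a : ¬ p ∣ᶻ a) (p∤m₀ : ¬ p ∣ᶻ m₀) where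

      p^m₁∣Z⇒p^m₁∣j² : ∀ j → p ℕ.^ m₁ ∣ᶻ Z j → p ℕ.^ m₁ ℕD.∣ j ℕ.* j
      p^m₁∣Z⇒p^m₁∣j² j pᵐ¹∣Z = S.∣⇒∣ᵤ (subst (_ ∣ᶻ_) (sym (pos-* j j)) (∣ᶻ-cancel-unit pr m₁ a (+ j * + j) p∤a
        (subst (_ ∣ᶻ_) (cancel (a * (+ j * + j)) (m₀ * + (p ℕ.^ m₁)))
          (S.∣m∣n⇒∣m+n pᵐ¹∣Z (S.∣n⇒∣m*n m₀ (∣ᶻ-self (p ℕ.^ m₁)))))))
        where
        cancel : ∀ x y → x - y + y ≡ x
        cancel = solve-∀

      p^m₁∣j²⇒p^m₁∣Z : ∀ j → p ℕ.^ m₁ ℕD.∣ j ℕ.* j → p ℕ.^ m₁ ∣ᶻ Z j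
      p^m₁∣j²⇒p^m₁∣Z j pᵐ¹∣j² = S.∣m∣n⇒∣m-n (S.∣n⇒∣m*n a (subst (_ ∣ᶻ_) (pos-* j j) (S.∣ᵤ⇒∣ pᵐ¹∣j²)))
        (S.∣n⇒∣m*n m₀ (∣ᶻ-self (p ℕ.^ m₁)))

      count-p^m₁∣Z-as-multiples : ∀ c K → n ≡ p ℕ.^ K ℕ.* p ℕ.^ c →
        (∀ j → p ℕ.^ m₁ ℕD.∣ j ℕ.* j → p ℕ.^ c ℕD.∣ j) →
        (∀ j → p ℕ.^ c ℕD.∣ j → p ℕ.^ m₁ ℕD.∣ j ℕ.* j) →
        count-p^m₁∣Z ≡ + (p ℕ.^ K)
      count-p^m₁∣Z-as-multiples c K n≡ to from = begin
        ∑< n (λ j → 𝟙 (p ℕ.^ m₁ ∣ᶻ? Z j))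
          ≡⟨ ∑<-cong n (λ j _ → 𝟙-⇔ (p ℕ.^ m₁ ∣ᶻ? Z j) (p ℕ.^ c ℕD.∣? j)
              (to j ∘ p^m₁∣Z⇒p^m₁∣j² j) (p^m₁∣j²⇒p^m₁∣Z j ∘ from j)) ⟩
        ∑< n (λ j → 𝟙 (p ℕ.^ c ℕD.∣? j))
          ≡⟨ cong (λ x → ∑< x (λ j → 𝟙 (p ℕ.^ c ℕD.∣? j))) n≡ ⟩
        ∑< (p ℕ.^ K ℕ.* p ℕ.^ c) (λ j → 𝟙 (p ℕ.^ c ℕD.∣? j))
          ≡⟨ count-multiples (p ℕ.^ K) (p ℕ.^ c) ⦃ ℕP.m^n≢0 p c ⦄ ⟩
        + (p ℕ.^ K) ∎

      count-p^m₁∣Z-even : ∀ l → m₁ ≡ l ℕ.+ l → count-p^m₁∣Z ≡ + (p ℕ.^ suc (l ℕ.+ τ))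
      count-p^m₁∣Z-even l m₁≡2l = count-p^m₁∣Z-as-multiples l (suc (l ℕ.+ τ)) (n≡p^[1+l+τ]*p^l l m₁≡2l)
        (λ j pᵐ¹∣j² → p^[2c]∣j²⇒p^c∣j pr l j (subst (λ e → p ℕ.^ e ℕD.∣ j ℕ.* j) m₁≡2l pᵐ¹∣j²))
        (λ j pˡ∣j → subst (λ e → p ℕ.^ e ℕD.∣ j ℕ.* j) (sym m₁≡2l) (p^c∣j⇒p^[2c]∣j² p l j pˡ∣j))
        where

      count-p^m₁∣Z-odd : ∀ l → m₁ ≡ suc (l ℕ.+ l) → count-p^m₁∣Z ≡ + (p ℕ.^ suc (l ℕ.+ τ))
      count-p^m₁∣Z-odd l m₁≡1+2l = count-p^m₁∣Z-as-multiples (suc l) (suc (l ℕ.+ τ)) (n≡p^[1+l+τ]*p^[1+l] l m₁≡1+2l)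
        (λ j pᵐ¹∣j² → p^[1+2c]∣j²⇒p^[1+c]∣j pr l j (subst (λ e → p ℕ.^ e ℕD.∣ j ℕ.* j) m₁≡1+2l pᵐ¹∣j²))
        (λ j p¹⁺ˡ∣j → subst (λ e → p ℕ.^ e ℕD.∣ j ℕ.* j) (sym m₁≡1+2l)
                        (ℕD.∣-trans (^-∣-^ p (ℕP.≤-trans (ℕP.n≤1+n _) (ℕP.≤-reflexive (sym (ℕP.+-suc (suc l) l)))))
                          (p^c∣j⇒p^[2c]∣j² p (suc l) j p¹⁺ˡ∣j)))
        where

      root-count : ℤ
      root-count = ∑< p (λ x → 𝟙 (p ∣ᶻ? a * (+ x * + x) - m₀))

      count-Q∣Z-odd : ∀ l → m₁ ≡ suc (l ℕ.+ l) → count-Q∣Z ≡ 0ℤ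
      count-Q∣Z-odd l m₁≡1+2l = ∑<-≡0 n _ (λ j _ → 𝟙-no (Q ∣ᶻ? Z j) (Q∤Z j))
        where
        cancel : ∀ x y → x - (x - y) ≡ y
        cancel = solve-∀
        Q∤Z : ∀ j → ¬ Q ∣ᶻ Z j
        Q∤Z j Q∣Z = p∤m₀ (∣ᶻ-*-cancelʳ p (p ℕ.^ m₁) m₀ ⦃ ℕP.m^n≢0 p m₁ ⦄ Q∣m₀pᵐ¹)
          where
          p¹⁺ˡ∣j : p ℕ.^ suc l ℕD.∣ j
          p¹⁺ˡ∣j = p^[1+2c]∣j²⇒p^[1+c]∣j pr l j (subst (λ e → p ℕ.^ e ℕD.∣ j ℕ.* j) m₁≡1+2l
                     (p^m₁∣Z⇒p^m₁∣j² j (∣ᶻ-weaken (ℕD.n∣m*n p) Q∣Z)))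
          Q∣j² : Q ℕD.∣ j ℕ.* j
          Q∣j² = subst (λ e → p ℕ.^ e ℕD.∣ j ℕ.* j) (trans (ℕP.+-suc (suc l) l) (cong suc (sym m₁≡1+2l)))
            (p^c∣j⇒p^[2c]∣j² p (suc l) j p¹⁺ˡ∣j)
          Q∣m₀pᵐ¹ : Q ∣ᶻ m₀ * + (p ℕ.^ m₁)
          Q∣m₀pᵐ¹ = subst (_ ∣ᶻ_) (cancel (a * (+ j * + j)) (m₀ * + (p ℕ.^ m₁)))
            (S.∣m∣n⇒∣m-n (S.∣n⇒∣m*n a (subst (_ ∣ᶻ_) (pos-* j j) (S.∣ᵤ⇒∣ Q∣j²))) Q∣Z)

      count-Q∣Z-even : ∀ l → m₁ ≡ l ℕ.+ l → count-Q∣Z ≡ + (p ℕ.^ (l ℕ.+ τ)) * root-count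
      count-Q∣Z-even l m₁≡2l = begin
        ∑< n (λ j → 𝟙 (Q ∣ᶻ? Z j))
          ≡⟨ cong (λ x → ∑< x (λ j → 𝟙 (Q ∣ᶻ? Z j))) (n≡p^[1+l+τ]*p^l l m₁≡2l) ⟩
        ∑< (p ℕ.^ suc (l ℕ.+ τ) ℕ.* P) (λ j → 𝟙 (Q ∣ᶻ? Z j))
          ≡⟨ ∑<-multiples (p ℕ.^ suc (l ℕ.+ τ)) P _ ⦃ ℕP.m^n≢0 p l ⦄ off-multiples ⟩
        ∑< (p ℕ.^ suc (l ℕ.+ τ)) (λ i → 𝟙 (Q ∣ᶻ? Z (i ℕ.* P)))
          ≡⟨ ∑<-cong (p ℕ.^ suc (l ℕ.+ τ)) (λ i _ → on-multiples i) ⟩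
        ∑< (p ℕ.^ suc (l ℕ.+ τ)) root?
          ≡⟨ cong (λ x → ∑< x root?) (ℕP.*-comm p (p ℕ.^ (l ℕ.+ τ))) ⟩
        ∑< (p ℕ.^ (l ℕ.+ τ) ℕ.* p) root?
          ≡⟨ ∑<-periodic (p ℕ.^ (l ℕ.+ τ)) p root? (𝟙-∣-quadratic-periodic p a m₀) ⟩
        + (p ℕ.^ (l ℕ.+ τ)) * root-count ∎
        where
        P = p ℕ.^ l
        root? : ℕ → ℤ
        root? x = 𝟙 (p ∣ᶻ? a * (+ x * + x) - m₀)
        off-multiples : ∀ j → ¬ P ℕD.∣ j → 𝟙 (Q ∣ᶻ? Z j) ≡ 0ℤ
        off-multiples j P∤j = 𝟙-no (Q ∣ᶻ? Z j) λ Q∣Z → P∤j (p^[2c]∣j²⇒p^c∣j pr l j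
          (subst (λ e → p ℕ.^ e ℕD.∣ j ℕ.* j) m₁≡2l (p^m₁∣Z⇒p^m₁∣j² j (∣ᶻ-weaken (ℕD.n∣m*n p) Q∣Z))))
        PP≡pᵐ¹ : P ℕ.* P ≡ p ℕ.^ m₁
        PP≡pᵐ¹ = trans (sym (ℕP.^-distribˡ-+-* p l l)) (cong (p ℕ.^_) (sym m₁≡2l))
        factor : ∀ a i P m → a * ((i * P) * (i * P)) - m * (P * P) ≡ (a * (i * i) - m) * (P * P)
        factor = solve-∀
        Z[iP] : ∀ i → Z (i ℕ.* P) ≡ (a * (+ i * + i) - m₀) * + (P ℕ.* P)
        Z[iP] i = begin
          a * (+ (i ℕ.* P) * + (i ℕ.* P)) - m₀ * + (p ℕ.^ m₁)
            ≡⟨ cong₂ (λ x y → a * (x * x) - m₀ * y) (pos-* i P) (trans (cong +_ (sym PP≡pᵐ¹)) (pos-* P P)) ⟩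
          a * ((+ i * + P) * (+ i * + P)) - m₀ * (+ P * + P)
            ≡⟨ factor a (+ i) (+ P) m₀ ⟩
          (a * (+ i * + i) - m₀) * (+ P * + P)
            ≡⟨ cong ((a * (+ i * + i) - m₀) *_) (sym (pos-* P P)) ⟩
          (a * (+ i * + i) - m₀) * + (P ℕ.* P) ∎
        Q≡pPP : Q ≡ p ℕ.* (P ℕ.* P)
        Q≡pPP = cong (p ℕ.*_) (sym PP≡pᵐ¹)
        on-multiples : ∀ i → 𝟙 (Q ∣ᶻ? Z (i ℕ.* P)) ≡ root? i
        on-multiples i = 𝟙-⇔ (Q ∣ᶻ? Z (i ℕ.* P)) (p ∣ᶻ? a * (+ i * + i) - m₀)
          (λ Q∣Z → ∣ᶻ-*-cancelʳ p (P ℕ.* P) _ ⦃ ℕP.m*n≢0 P P ⦃ ℕP.m^n≢0 p l ⦄ ⦃ ℕP.m^n≢0 p l ⦄ ⦄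
            (subst₂ _∣ᶻ_ Q≡pPP (Z[iP] i) Q∣Z))
          (λ p∣root → subst₂ _∣ᶻ_ (sym Q≡pPP) (sym (Z[iP] i)) (∣ᶻ-*-mono p∣root (∣ᶻ-self (P ℕ.* P))))

      -- 3k + l = 2k + m₁ + (l + τ + 1) because k = m₁ + τ + 1.
      p^[3k+l] : ∀ l → + (p ℕ.^ (3 ℕ.* k ℕ.+ l)) ≡ + n * (+ n * (+ (p ℕ.^ m₁) * (+ p * + (p ℕ.^ (l ℕ.+ τ)))))
      p^[3k+l] l = begin
        + (p ℕ.^ (3 ℕ.* k ℕ.+ l))
          ≡⟨ cong (λ e → + (p ℕ.^ e)) (regroup m₁ τ l) ⟩
        + (p ℕ.^ (k ℕ.+ (k ℕ.+ (m₁ ℕ.+ suc (l ℕ.+ τ)))))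
          ≡⟨ pow-+ k _ ⟩
        + n * + (p ℕ.^ (k ℕ.+ (m₁ ℕ.+ suc (l ℕ.+ τ))))
          ≡⟨ cong (+ n *_) (pow-+ k _) ⟩
        + n * (+ n * + (p ℕ.^ (m₁ ℕ.+ suc (l ℕ.+ τ))))
          ≡⟨ cong (λ x → + n * (+ n * x)) (trans (pow-+ m₁ _) (cong (+ (p ℕ.^ m₁) *_) (pos-* p _))) ⟩
        + n * (+ n * (+ (p ℕ.^ m₁) * (+ p * + (p ℕ.^ (l ℕ.+ τ))))) ∎
        where
        regroup : ∀ m₁ τ l → 3 ℕ.* suc (m₁ ℕ.+ τ) ℕ.+ l
          ≡ suc (m₁ ℕ.+ τ) ℕ.+ (suc (m₁ ℕ.+ τ) ℕ.+ (m₁ ℕ.+ suc (l ℕ.+ τ)))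
        regroup = solveℕ-∀
        pow-+ : ∀ x y → + (p ℕ.^ (x ℕ.+ y)) ≡ + (p ℕ.^ x) * + (p ℕ.^ y)
        pow-+ x y = trans (cong +_ (ℕP.^-distribˡ-+-* p x y)) (pos-* (p ℕ.^ x) (p ℕ.^ y))

      n²-multiplicity-gap-even : ¬ 2 ℕD.∣ p → ∀ l → m₁ ≡ l ℕ.+ l →
        + n * (+ n * (multiplicity 0 - multiplicity N)) ≡ + (p ℕ.^ (3 ℕ.* k ℕ.+ l)) * legendre (a * m₀) p
      n²-multiplicity-gap-even p-odd l m₁≡2l = begin
        + n * (+ n * (multiplicity 0 - multiplicity N))
          ≡⟨ cong (λ x → + n * (+ n * x)) multiplicity-gap ⟩
        + n * (+ n * (P * (+ p * count-Q∣Z - count-p^m₁∣Z)))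
          ≡⟨ cong₂ (λ x y → + n * (+ n * (P * (+ p * x - y))))
              (count-Q∣Z-even l m₁≡2l) (trans (count-p^m₁∣Z-even l m₁≡2l) (pos-* p _)) ⟩
        + n * (+ n * (P * (+ p * (Pˡ * root-count) - + p * Pˡ)))
          ≡⟨ cong (λ x → + n * (+ n * (P * (+ p * (Pˡ * x) - + p * Pˡ)))) (count-roots pr p-odd a m₀ p∤a p∤m₀) ⟩
        + n * (+ n * (P * (+ p * (Pˡ * (1ℤ + L)) - + p * Pˡ)))
          ≡⟨ collect (+ n) P (+ p) Pˡ L ⟩
        + n * (+ n * (P * (+ p * Pˡ))) * L
          ≡⟨ cong (_* L) (sym (p^[3k+l] l)) ⟩
        + (p ℕ.^ (3 ℕ.* k ℕ.+ l)) * L ∎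
        where
        P = + (p ℕ.^ m₁)
        Pˡ = + (p ℕ.^ (l ℕ.+ τ))
        L = legendre (a * m₀) p
        collect : ∀ n P p Q L → n * (n * (P * (p * (Q * (1ℤ + L)) - p * Q))) ≡ n * (n * (P * (p * Q))) * L
        collect = solve-∀

      n²-multiplicity-gap-odd : ∀ l → m₁ ≡ suc (l ℕ.+ l) →
        + n * (+ n * (multiplicity 0 - multiplicity N)) ≡ - + (p ℕ.^ (3 ℕ.* k ℕ.+ l))
      n²-multiplicity-gap-odd l m₁≡1+2l = begin
        + n * (+ n * (multiplicity 0 - multiplicity N))
          ≡⟨ cong (λ x → + n * (+ n * x)) multiplicity-gap ⟩
        + n * (+ n * (P * (+ p * count-Q∣Z - count-p^m₁∣Z)))
          ≡⟨ cong₂ (λ x y → + n * (+ n * (P * (+ p * x - y))))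
              (count-Q∣Z-odd l m₁≡1+2l) (trans (count-p^m₁∣Z-odd l m₁≡1+2l) (pos-* p _)) ⟩
        + n * (+ n * (P * (+ p * 0ℤ - + p * Pˡ)))
          ≡⟨ collect (+ n) P (+ p) Pˡ ⟩
        - (+ n * (+ n * (P * (+ p * Pˡ))))
          ≡⟨ cong -_ (sym (p^[3k+l] l)) ⟩
        - + (p ℕ.^ (3 ℕ.* k ℕ.+ l)) ∎
        where
        P = + (p ℕ.^ m₁)
        Pˡ = + (p ℕ.^ (l ℕ.+ τ))
        collect : ∀ n P p Q → n * (n * (P * (p * 0ℤ - p * Q))) ≡ - (n * (n * (P * (p * Q))))
        collect = solve-∀

open import Data.Nat using (ℕ; _≤_; _<_; _+_; _*_; _^_; _∸_)
open import Data.Nat.Primality using (Prime)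
open import Data.Nat.Divisibility using (_∣_)
open import Data.Nat.Coprimality using (Coprime)
open import Data.Integer using (ℤ; +_; ∣_∣; -_)
open import Data.Integer as ℤ using ()
open import Data.Product using (_×_)
open import Relation.Binary.PropositionalEquality using (_≡_)
open import Relation.Nullary using (¬_)

open import Data.Nat using (suc)
open import Data.Nat.Properties using (+-identityʳ; +-comm; +-monoˡ-≤; ≤-trans; m+[n∸m]≡n; ∸-+-assoc)
open import Data.Nat.Divisibility using (∣-refl)
open import Data.Integer.Divisibility.Signed using (∣⇒∣ᵤ)
open import Data.Product using (_,_)
open import Function using (_∘_)
open import Relation.Binary.PropositionalEquality using (refl; sym; trans; cong)
open IntegerDivisibility using (_∣ᶻ_)
open PrimePowerResidues using (coprime⇒¬∣)
open Sₖτ using (sₖτ≈const; n²-multiplicity-gap-even; n²-multiplicity-gap-odd)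

lemma4p4 : (p : ℕ) → Prime p → ¬ (2 ∣ p) →
  (a : ℤ) → ¬ (p ∣ ∣ a ∣) →
  (b₀ : ℤ) (b₁ : ℕ) (c₀ : ℤ) (c₁ : ℕ) → b₁ ≤ c₁ →
  Coprime ∣ b₀ ∣ p → Coprime ∣ c₀ ∣ p →
  (m₀ : ℤ) (m₁ : ℕ) → Coprime ∣ m₀ ∣ p →
  (k : ℕ) → m₁ < k → m₁ < b₁ →
  ((l : ℕ) → m₁ ≡ 2 * l →
     CycEq p k (sₖτ p a b₀ b₁ c₀ c₁ m₀ m₁ k (k ∸ m₁ ∸ 1))
       (const (+ (p ^ (3 * k + l)) ℤ.* legendre (a ℤ.* m₀) p)))
  ×
  ((l : ℕ) → m₁ ≡ 2 * l + 1 →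
     CycEq p k (sₖτ p a b₀ b₁ c₀ c₁ m₀ m₁ k (k ∸ m₁ ∸ 1))
       (const (- + (p ^ (3 * k + l)))))
lemma4p4 p pr p-odd a p∤a b₀ b₁ c₀ c₁ b₁≤c₁ _ _ m₀ m₁ m₀⊥p k m₁<k m₁<b₁
  with k ∸ m₁ ∸ 1 | k≡1+m₁+[k∸m₁∸1]
  where
  k≡1+m₁+[k∸m₁∸1] : k ≡ suc (m₁ + (k ∸ m₁ ∸ 1))
  k≡1+m₁+[k∸m₁∸1] = trans (sym (m+[n∸m]≡n m₁<k))
    (cong (λ x → suc (m₁ + x)) (trans (cong (k ∸_) (+-comm 1 m₁)) (sym (∸-+-assoc k m₁ 1))))
... | τ | refl =
  (λ l m₁≡2l → sₖτ≈const pr a m₀ m₁ τ b₀ b₁ c₀ c₁ k≤b₁+τ k≤c₁+τ _ (n²-multiplicity-gap-even pr a m₀ m₁ τ p∤ᶻa p∤ᶻm₀ p-odd l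
    (trans m₁≡2l (cong (_+_ l) (+-identityʳ l))))) ,
  (λ l m₁≡2l+1 → sₖτ≈const pr a m₀ m₁ τ b₀ b₁ c₀ c₁ k≤b₁+τ k≤c₁+τ _ (n²-multiplicity-gap-odd pr a m₀ m₁ τ p∤ᶻa p∤ᶻm₀ l
    (trans m₁≡2l+1 (trans (+-comm (2 * l) 1) (cong (λ x → suc (l + x)) (+-identityʳ l))))))
  where
  k≤b₁+τ : suc (m₁ + τ) ≤ b₁ + τ
  k≤b₁+τ = +-monoˡ-≤ τ m₁<b₁
  k≤c₁+τ : suc (m₁ + τ) ≤ c₁ + τ
  k≤c₁+τ = ≤-trans k≤b₁+τ (+-monoˡ-≤ τ b₁≤c₁)
  p∤ᶻa : ¬ p ∣ᶻ a
  p∤ᶻa = p∤a ∘ ∣⇒∣ᵤ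
  p∤ᶻm₀ : ¬ p ∣ᶻ m₀
  p∤ᶻm₀ = coprime⇒¬∣ pr ∣-refl m₀⊥p ∘ ∣⇒∣ᵤ
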